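{- Consider the judgments $\Gamma\vdash_{ps}$ and $\Gamma\vdash_{ps}\Delta$ (with $\Gamma,\Delta$ contexts) generated by the rules: $x:\star\vdash_{ps}x:\star$; from $\Gamma\vdash_{ps}\Delta,x:A,\Delta'$ infer $\Gamma,y:A,f:\mathrm{Hom}_A(x,y)\vdash_{ps}\Delta,\Delta',y:A,f:\mathrm{Hom}_A(x,y)$, where $y$ and $f$ are fresh in $\Gamma$; and from $\Gamma\vdash_{ps}\Delta$ infer $\Gamma\vdash_{ps}$. Then for every context $\Gamma$ such that $\Gamma\vdash_{ps}$ is derivable, $G^\Gamma$ is a pasting scheme, and conversely every pasting scheme is isomorphic to $G^\Gamma$ for some such $\Gamma$.
   Context: Types over a fixed countably infinite set of variables: $\star$ and $\mathrm{Hom}_A(t,u)$ for a type $A$ and variables $t,u$; $\dim\star=0$, $\dim\mathrm{Hom}_A(t,u)=\dim A+1$. Contexts are finite lists $x_1:A_1,\dots,x_n:A_n$ (lists $\Delta,\Delta'$ may be empty); "fresh in $\Gamma$" means not occurring in $\Gamma$. For a context $\Gamma=(x_i:A_i)_{1\le i\le k}$, $G^\Gamma$ is the globular set whose $n$-cells are the pairs $(x_i,i)$ with $\dim A_i=n$, the source and target of $(x_i,i)$ with $A_i=\mathrm{Hom}_B(y,z)$ being the cells corresponding to the entries declaring $y$ and $z$ (here variables are distinct, so one may take the cells to be the variables themselves). Globular sets: sets $(G_n)_{n\in\mathbb N}$ with $s_n,t_n:G_{n+1}\to G_n$, $s_n s_{n+1}=s_n t_{n+1}$, $t_n s_{n+1}=t_n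 t_{n+1}$. $D_n$ is the $n$-disk (cells $x_k^\pm$ for $k<n$ and $x_n$, with $s(x_{k+1}^\pm)=x_k^-$, $t(x_{k+1}^\pm)=x_k^+$, $s(x_n)=x_{n-1}^-$, $t(x_n)=x_{n-1}^+$); for $j\le i$, $\sigma^i_j,\tau^i_j:D_j\to D_i$ fix $x_k^\pm$ ($k<j$) and send $x_j$ to $x_j^-$, resp. $x_j^+$ (identities if $j=i$). A pasting scheme is a globular set isomorphic to a colimit of a diagram $D_{i_0}\xleftarrow{\tau^{i_0}_{j_1}}D_{j_1}\xrightarrow{\sigma^{i_1}_{j_1}}D_{i_1}\leftarrow\cdots\leftarrow D_{j_k}\xrightarrow{\sigma^{i_k}_{j_k}}D_{i_k}$ ($k\ge0$, $j_m\le\min(i_{m-1},i_m)$). -}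

module Defs where

open import Data.Nat using (ℕ; zero; suc; _≤_; z≤n; s≤s)
open import Data.Bool using (Bool; true; false)
open import Data.Unit using (⊤; tt)
open import Data.Empty using (⊥)
open import Data.Fin using (Fin; inject₁) renaming (suc to fsuc)
open import Data.List using (List; []; _∷_; _++_; [_]; length; lookup)
open import Data.List.Relation.Unary.Any using (Any)
open import Data.Product using (Σ; Σ-syntax; _×_; _,_; proj₁; proj₂)
open import Data.Sum using (_⊎_)
open import Relation.Nullary using (¬_)
open import Relation.Binary.PropositionalEquality using (_≡_; _≢_; refl)
open import Function.Bundles using (_↔_; _⇔_)

Var : Set
Var = ℕ

data Ty : Set where
  ⋆   : Ty
  Hom : Ty → Var → Var → Ty

dim : Ty → ℕ
dim ⋆ = zero
dim (Hom A _ _) = suc (dim A)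

-- a context x₁ : A₁, …, xₙ : Aₙ, listed left to right
Ctx : Set
Ctx = List (Var × Ty)

OccTy : Var → Ty → Set
OccTy x ⋆ = ⊥
OccTy x (Hom A y z) = (x ≡ y ⊎ x ≡ z) ⊎ OccTy x A

OccEntry : Var → Var × Ty → Set
OccEntry x (v , A) = x ≡ v ⊎ OccTy x A

Fresh : Var → Ctx → Set
Fresh x Γ = ¬ Any (OccEntry x) Γ

infix 4 _⊢ps_ _⊢ps

data _⊢ps_ : Ctx → Ctx → Set where
  ps-start : (x : Var) → [ (x , ⋆) ] ⊢ps [ (x , ⋆) ]
  ps-ext   : ∀ {Γ} (Δ : Ctx) (x : Var) (A : Ty) (Δ' : Ctx) (y f : Var) →
             Γ ⊢ps (Δ ++ (x , A) ∷ Δ') →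
             Fresh y Γ → Fresh f Γ → y ≢ f →
             (Γ ++ (y , A) ∷ (f , Hom A x y) ∷ [])
               ⊢ps (Δ ++ Δ' ++ (y , A) ∷ (f , Hom A x y) ∷ [])

data _⊢ps : Ctx → Set where
  ps-done : ∀ {Γ Δ} → Γ ⊢ps Δ → Γ ⊢ps

record GSet : Set₁ where
  field
    Cell : ℕ → Set
    src  : ∀ n → Cell (suc n) → Cell n
    tgt  : ∀ n → Cell (suc n) → Cell n
    glob-s : ∀ n (c : Cell (suc (suc n))) → src n (src (suc n) c) ≡ src n (tgt (suc n) c)
    glob-t : ∀ n (c : Cell (suc (suc n))) → tgt n (src (suc n) c) ≡ tgt n (tgt (suc n) c)
open GSet public

record GHom (G H : GSet) : Set where
  field
    map   : ∀ n → Cell G n → Cell H n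
    map-s : ∀ n (c : Cell G (suc n)) → map n (src G n c) ≡ src H n (map (suc n) c)
    map-t : ∀ n (c : Cell G (suc n)) → map n (tgt G n c) ≡ tgt H n (map (suc n) c)
open GHom public

_∘G_ : ∀ {G H K} → GHom H K → GHom G H → GHom G K
_∘G_ {G} {H} {K} g f = record
  { map   = λ n c → map g n (map f n c)
  ; map-s = λ n c → trans' (cong' (map g n) (map-s f n c)) (map-s g n (map f (suc n) c))
  ; map-t = λ n c → trans' (cong' (map g n) (map-t f n c)) (map-t g n (map f (suc n) c))
  }
  where
  trans' : ∀ {A : Set} {a b c : A} → a ≡ b → b ≡ c → a ≡ c
  trans' refl q = q
  cong' : ∀ {A B : Set} (h : A → B) {a b : A} → a ≡ b → h a ≡ h b
  cong' h refl = refl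

_≈G_ : ∀ {G H} → GHom G H → GHom G H → Set
_≈G_ {G} f g = ∀ n (c : Cell G n) → map f n c ≡ map g n c

-- Disks D_n.  Cells of dimension k: for k < n the two cells x_k^- (false)
-- and x_k^+ (true); for k = n the single cell x_n; none above n.

DCell : ℕ → ℕ → Set
DCell zero zero = ⊤
DCell zero (suc k) = ⊥
DCell (suc n) zero = Bool
DCell (suc n) (suc k) = DCell n k

Dsrc : ∀ n k → DCell n (suc k) → DCell n k
Dsrc zero k ()
Dsrc (suc n) zero _ = false
Dsrc (suc n) (suc k) c = Dsrc n k c

Dtgt : ∀ n k → DCell n (suc k) → DCell n k
Dtgt zero k ()
Dtgt (suc n) zero _ = true
Dtgt (suc n) (suc k) c = Dtgt n k c

Dglob-s : ∀ n k (c : DCell n (suc (suc k))) →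
          Dsrc n k (Dsrc n (suc k) c) ≡ Dsrc n k (Dtgt n (suc k) c)
Dglob-s zero k ()
Dglob-s (suc n) zero c = refl
Dglob-s (suc n) (suc k) c = Dglob-s n k c

Dglob-t : ∀ n k (c : DCell n (suc (suc k))) →
          Dtgt n k (Dsrc n (suc k) c) ≡ Dtgt n k (Dtgt n (suc k) c)
Dglob-t zero k ()
Dglob-t (suc n) zero c = refl
Dglob-t (suc n) (suc k) c = Dglob-t n k c

D : ℕ → GSet
D n = record
  { Cell = DCell n ; src = Dsrc n ; tgt = Dtgt n
  ; glob-s = Dglob-s n ; glob-t = Dglob-t n }

-- σ^i_j and τ^i_j : D_j → D_i (j ≤ i): fix x_k^± (k < j), send x_j to
-- x_j^- (resp. x_j^+), or to x_j when j = i.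
σmap : ∀ {j i} → j ≤ i → ∀ k → DCell j k → DCell i k
σmap {i = zero}  z≤n zero c = c
σmap {i = suc i} z≤n zero _ = false
σmap z≤n (suc k) ()
σmap (s≤s p) zero b = b
σmap (s≤s p) (suc k) c = σmap p k c

τmap : ∀ {j i} → j ≤ i → ∀ k → DCell j k → DCell i k
τmap {i = zero}  z≤n zero c = c
τmap {i = suc i} z≤n zero _ = true
τmap z≤n (suc k) ()
τmap (s≤s p) zero b = b
τmap (s≤s p) (suc k) c = τmap p k c

σmap-s : ∀ {j i} (p : j ≤ i) k (c : DCell j (suc k)) →
         σmap p k (Dsrc j k c) ≡ Dsrc i k (σmap p (suc k) c)
σmap-s z≤n k ()
σmap-s (s≤s p) zero c = refl
σmap-s (s≤s p) (suc k) c = σmap-s p k c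

σmap-t : ∀ {j i} (p : j ≤ i) k (c : DCell j (suc k)) →
         σmap p k (Dtgt j k c) ≡ Dtgt i k (σmap p (suc k) c)
σmap-t z≤n k ()
σmap-t (s≤s p) zero c = refl
σmap-t (s≤s p) (suc k) c = σmap-t p k c

τmap-s : ∀ {j i} (p : j ≤ i) k (c : DCell j (suc k)) →
         τmap p k (Dsrc j k c) ≡ Dsrc i k (τmap p (suc k) c)
τmap-s z≤n k ()
τmap-s (s≤s p) zero c = refl
τmap-s (s≤s p) (suc k) c = τmap-s p k c

τmap-t : ∀ {j i} (p : j ≤ i) k (c : DCell j (suc k)) →
         τmap p k (Dtgt j k c) ≡ Dtgt i k (τmap p (suc k) c)
τmap-t z≤n k ()
τmap-t (s≤s p) zero c = refl
τmap-t (s≤s p) (suc k) c = τmap-t p k c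

σ : ∀ {j i} → j ≤ i → GHom (D j) (D i)
σ p = record { map = σmap p ; map-s = σmap-s p ; map-t = σmap-t p }

τ : ∀ {j i} → j ≤ i → GHom (D j) (D i)
τ p = record { map = τmap p ; map-s = τmap-s p ; map-t = τmap-t p }

-- Pasting diagrams
--   D_{i_0} ←τ− D_{j_1} −σ→ D_{i_1} ← ⋯ ← D_{j_k} −σ→ D_{i_k}
-- with j_m ≤ min(i_{m-1}, i_m).  Index m : Fin k stands for j_{m+1}.

record Zigzag : Set where
  field
    len  : ℕ
    i    : Fin (suc len) → ℕ
    j    : Fin len → ℕ
    j≤il : ∀ m → j m ≤ i (inject₁ m)
    j≤ir : ∀ m → j m ≤ i (fsuc m)
open Zigzag public

record Cocone (Z : Zigzag) (Q : GSet) : Set where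
  field
    leg    : ∀ m → GHom (D (i Z m)) Q
    commut : ∀ m → (leg (inject₁ m) ∘G τ (j≤il Z m)) ≈G (leg (fsuc m) ∘G σ (j≤ir Z m))
open Cocone public

IsColimit : (Z : Zigzag) (P : GSet) → Cocone Z P → Set₁
IsColimit Z P c =
  (Q : GSet) (d : Cocone Z Q) →
    Σ[ u ∈ GHom P Q ]
      ((∀ m → (u ∘G leg c m) ≈G leg d m) ×
       ((u' : GHom P Q) → (∀ m → (u' ∘G leg c m) ≈G leg d m) → u' ≈G u))

IsPastingScheme : GSet → Set₁
IsPastingScheme P = Σ[ Z ∈ Zigzag ] Σ[ c ∈ Cocone Z P ] IsColimit Z P c

-- Source/target are given
-- as relations: (x_j, j) is the source (target) of (x_i, i) when
-- A_i = Hom_B(y, z) and x_j = y (resp. x_j = z).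

entryVar : (Γ : Ctx) → Fin (length Γ) → Var
entryVar Γ e = proj₁ (lookup Γ e)

entryTy : (Γ : Ctx) → Fin (length Γ) → Ty
entryTy Γ e = proj₂ (lookup Γ e)

GΓCell : Ctx → ℕ → Set
GΓCell Γ n = Σ[ e ∈ Fin (length Γ) ] dim (entryTy Γ e) ≡ n

GΓSrc : (Γ : Ctx) → ∀ n → GΓCell Γ (suc n) → GΓCell Γ n → Set
GΓSrc Γ n (e , _) (e' , _) =
  Σ[ B ∈ Ty ] Σ[ y ∈ Var ] Σ[ z ∈ Var ] (entryTy Γ e ≡ Hom B y z × entryVar Γ e' ≡ y)

GΓTgt : (Γ : Ctx) → ∀ n → GΓCell Γ (suc n) → GΓCell Γ n → Set
GΓTgt Γ n (e , _) (e' , _) =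
  Σ[ B ∈ Ty ] Σ[ y ∈ Var ] Σ[ z ∈ Var ] (entryTy Γ e ≡ Hom B y z × entryVar Γ e' ≡ z)

-- An isomorphism of globular sets P ≅ G^Γ: bijections on n-cells under
-- which the source/target functions of P correspond exactly to the
-- source/target relations of G^Γ.
record _≅GΓ_ (P : GSet) (Γ : Ctx) : Set where
  field
    bij   : ∀ n → Cell P n ↔ GΓCell Γ n
  open Function.Bundles.Inverse
  field
    src≅ : ∀ n (c : Cell P (suc n)) (d : Cell P n) →
           (d ≡ src P n c) ⇔ GΓSrc Γ n (to (bij (suc n)) c) (to (bij n) d)
    tgt≅ : ∀ n (c : Cell P (suc n)) (d : Cell P n) →
           (d ≡ tgt P n c) ⇔ GΓTgt Γ n (to (bij (suc n)) c) (to (bij n) d)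

-- Gluing a disk D (d+1) along σ : D d → D (d+1) onto a d-cell c adds a d-cell y parallel to c and
-- a (d+1)-cell f : c → y; on G^Γ this is exactly the extension rule of ⊢ps applied to the entry of c.
-- A derivation of Γ ⊢ps Δ is thus an iterated gluing. Along it we keep a zigzag whose colimit is
-- G^Γ and in which every entry of Δ is a free target face ("slot") of one of its disks; extending at
-- a slot inserts D (d+1) into the zigzag right after that disk, and this preserves the colimit.
-- Conversely, the colimit of a zigzag is built from left to right: gluing D i along σ : D j → D i
-- is i ∸ j successive one-cell gluings at target faces of the last disk, each an instance of the
-- extension rule since those faces stay in Δ. Uniqueness of colimits then transfers the
-- isomorphism with G^Γ to any pasting scheme.
module Submission where

open import Defs
open import Data.Bool using (true; false)
open import Data.Empty using (⊥-elim)
open import Data.Fin using (Fin; zero; inject₁; fromℕ) renaming (suc to fsuc)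
open import Data.Fin.Relation.Unary.Top using (View; view; view-fromℕ; view-inject₁; ‵fromℕ; ‵inj₁)
open import Data.List using ([]; _∷_; _++_; length; lookup)
open import Data.List.Membership.Propositional using (_∈_; _∉_; lose)
open import Data.List.Membership.Propositional.Properties
  using (∈-lookup; ∈-++⁺ˡ; ∈-++⁺ʳ; ∈-++⁻; ∈-insert; ∈-∃++)
open import Data.List.Properties using (++-assoc)
open import Data.List.Relation.Unary.All as All using (All; []; _∷_)
open import Data.List.Relation.Unary.AllPairs using ([]; _∷_)
open import Data.List.Relation.Unary.Any using (Any; here; there)
open import Data.List.Relation.Unary.Any.Properties using (++⁻)
open import Data.List.Relation.Unary.Unique.Propositional using (Unique)
import Data.List.Relation.Unary.Unique.Propositional.Properties as Unique
open import Data.Nat using (ℕ; zero; suc; _≤_; _<_; z≤n; s≤s; _≤′_; ≤′-refl; ≤′-step)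
open import Data.Nat.Properties
  using (≤-irrelevant; ≡-irrelevant; ≤-refl; ≤-trans; n≤1+n; n<1+n; <⇒≤; m≤n⇒m≤1+n; m<n⇒m≤1+n; m<n⇒m<1+n;
         <-irrefl; <-≤-trans; <-cmp; ≤′⇒≤; ≤⇒≤′; m≤n⇒m<n∨m≡n)
open import Data.Product using (Σ-syntax; _×_; _,_; proj₁; proj₂)
open import Data.Sum using (_⊎_; inj₁; inj₂)
open import Data.Sum.Function.Propositional using (_⊎-↔_)
open import Data.Sum.Properties using (inj₁-injective)
open import Data.Unit using (tt)
open import Function.Base using (_∘_)
open import Function.Bundles using (_↔_; _⇔_; mk↔ₛ′; mk⇔; Inverse; Equivalence)
open import Function.Construct.Composition using (_↔-∘_; _⇔-∘_)
open import Function.Construct.Symmetry using (⇔-sym)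
open import Relation.Binary using (tri<; tri≈; tri>)
open import Relation.Binary.PropositionalEquality
open import Relation.Nullary using (¬_)
open import Data.List.Relation.Binary.Permutation.Setoid (setoid (Var × Ty)) using (↭-sym)
open import Data.List.Relation.Binary.Permutation.Setoid.Properties (setoid (Var × Ty))
  using (↭-shift; ∈-resp-↭; Unique-resp-↭)

open Inverse using (to; from; strictlyInverseˡ; strictlyInverseʳ)

-- Disks and their morphisms

idG : ∀ {G} → GHom G G
idG = record { map = λ _ c → c ; map-s = λ _ _ → refl ; map-t = λ _ _ → refl }

shift : GSet → GSet
shift G = record
  { Cell = λ n → Cell G (suc n) ; src = λ n → src G (suc n) ; tgt = λ n → tgt G (suc n)
  ; glob-s = λ n → glob-s G (suc n) ; glob-t = λ n → glob-t G (suc n) }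

src₀ tgt₀ : (G : GSet) → ∀ n → Cell G n → Cell G 0
src₀ G zero c = c
src₀ G (suc n) c = src₀ G n (src G n c)
tgt₀ G zero c = c
tgt₀ G (suc n) c = tgt₀ G n (tgt G n c)

src-shift-src₀ : ∀ G m (c : Cell G (suc m)) → src G 0 (src₀ (shift G) m c) ≡ src₀ G (suc m) c
src-shift-src₀ G zero c = refl
src-shift-src₀ G (suc m) c = src-shift-src₀ G m (src G (suc m) c)

src-shift-tgt₀ : ∀ G m (c : Cell G (suc m)) → src G 0 (tgt₀ (shift G) m c) ≡ src₀ G (suc m) c
src-shift-tgt₀ G zero c = refl
src-shift-tgt₀ G (suc m) c =
  trans (src-shift-tgt₀ G m (tgt G (suc m) c)) (cong (src₀ G m) (sym (glob-s G m c)))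

tgt-shift-src₀ : ∀ G m (c : Cell G (suc m)) → tgt G 0 (src₀ (shift G) m c) ≡ tgt₀ G (suc m) c
tgt-shift-src₀ G zero c = refl
tgt-shift-src₀ G (suc m) c =
  trans (tgt-shift-src₀ G m (src G (suc m) c)) (cong (tgt₀ G m) (glob-t G m c))

tgt-shift-tgt₀ : ∀ G m (c : Cell G (suc m)) → tgt G 0 (tgt₀ (shift G) m c) ≡ tgt₀ G (suc m) c
tgt-shift-tgt₀ G zero c = refl
tgt-shift-tgt₀ G (suc m) c = tgt-shift-tgt₀ G m (tgt G (suc m) c)

top : ∀ n → DCell n n
top zero = tt
top (suc n) = top n

someEdge : ∀ n → DCell (suc n) 1
someEdge zero = tt
someEdge (suc n) = false

diskCell : (G : GSet) (n : ℕ) → Cell G n → ∀ k → DCell n k → Cell G k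
diskCell G zero c zero tt = c
diskCell G (suc n) c zero false = src₀ G (suc n) c
diskCell G (suc n) c zero true = tgt₀ G (suc n) c
diskCell G (suc n) c (suc k) d = diskCell (shift G) n c k d

src-diskCell-shift : ∀ G n (c : Cell G (suc n)) (d : DCell n 0) →
                     src G 0 (diskCell (shift G) n c 0 d) ≡ src₀ G (suc n) c
src-diskCell-shift G zero c tt = refl
src-diskCell-shift G (suc n) c false = src-shift-src₀ G (suc n) c
src-diskCell-shift G (suc n) c true = src-shift-tgt₀ G (suc n) c

tgt-diskCell-shift : ∀ G n (c : Cell G (suc n)) (d : DCell n 0) →
                     tgt G 0 (diskCell (shift G) n c 0 d) ≡ tgt₀ G (suc n) c
tgt-diskCell-shift G zero c tt = refl
tgt-diskCell-shift G (suc n) c false = tgt-shift-src₀ G (suc n) c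
tgt-diskCell-shift G (suc n) c true = tgt-shift-tgt₀ G (suc n) c

diskCell-src : ∀ G n (c : Cell G n) k (d : DCell n (suc k)) →
               diskCell G n c k (Dsrc n k d) ≡ src G k (diskCell G n c (suc k) d)
diskCell-src G (suc n) c zero d = sym (src-diskCell-shift G n c d)
diskCell-src G (suc n) c (suc k) d = diskCell-src (shift G) n c k d

diskCell-tgt : ∀ G n (c : Cell G n) k (d : DCell n (suc k)) →
               diskCell G n c k (Dtgt n k d) ≡ tgt G k (diskCell G n c (suc k) d)
diskCell-tgt G (suc n) c zero d = sym (tgt-diskCell-shift G n c d)
diskCell-tgt G (suc n) c (suc k) d = diskCell-tgt (shift G) n c k d

diskMap : (G : GSet) (n : ℕ) → Cell G n → GHom (D n) G
diskMap G n c = record { map = diskCell G n c ; map-s = diskCell-src G n c ; map-t = diskCell-tgt G n c }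

diskCell-top : ∀ G n (c : Cell G n) → diskCell G n c n (top n) ≡ c
diskCell-top G zero c = refl
diskCell-top G (suc n) c = diskCell-top (shift G) n c

topCell : ∀ {G n} → GHom (D n) G → Cell G n
topCell {n = n} h = map h n (top n)

shiftHom : ∀ {n Q} → GHom (D (suc n)) Q → GHom (D n) (shift Q)
shiftHom h = record
  { map = λ k → map h (suc k) ; map-s = λ k → map-s h (suc k) ; map-t = λ k → map-t h (suc k) }

diskMap-topCell : ∀ {Q} n (h : GHom (D n) Q) → h ≈G diskMap Q n (topCell h)
diskMap-topCell zero h zero tt = refl
diskMap-topCell {Q} (suc n) h zero false =
  trans (map-s h 0 (someEdge n))
    (trans (cong (src Q 0) (diskMap-topCell n (shiftHom h) 0 (someEdge n)))
           (src-diskCell-shift Q n _ (someEdge n)))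
diskMap-topCell {Q} (suc n) h zero true =
  trans (map-t h 0 (someEdge n))
    (trans (cong (tgt Q 0) (diskMap-topCell n (shiftHom h) 0 (someEdge n)))
           (tgt-diskCell-shift Q n _ (someEdge n)))
diskMap-topCell (suc n) h (suc k) d = diskMap-topCell n (shiftHom h) k d

≈G-topCell : ∀ {Q n} (h h′ : GHom (D n) Q) → topCell h ≡ topCell h′ → h ≈G h′
≈G-topCell {Q} {n} h h′ e k d =
  trans (diskMap-topCell n h k d)
    (trans (cong (λ c → diskCell Q n c k d) e) (sym (diskMap-topCell n h′ k d)))

Dsrc-const : ∀ i k (d d′ : DCell i (suc k)) → Dsrc i k d ≡ Dsrc i k d′
Dsrc-const (suc i) zero d d′ = refl
Dsrc-const (suc i) (suc k) d d′ = Dsrc-const i k d d′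

Dtgt-const : ∀ i k (d d′ : DCell i (suc k)) → Dtgt i k d ≡ Dtgt i k d′
Dtgt-const (suc i) zero d d′ = refl
Dtgt-const (suc i) (suc k) d d′ = Dtgt-const i k d d′

σ-top : ∀ n (p : n ≤ suc n) → σmap p n (top n) ≡ Dsrc (suc n) n (top (suc n))
σ-top zero z≤n = refl
σ-top (suc n) (s≤s p) = σ-top n p

τ-top : ∀ n (p : n ≤ suc n) → τmap p n (top n) ≡ Dtgt (suc n) n (top (suc n))
τ-top zero z≤n = refl
τ-top (suc n) (s≤s p) = τ-top n p

σ-refl : ∀ {j} (p : j ≤ j) k (d : DCell j k) → σmap p k d ≡ d
σ-refl {zero} z≤n zero tt = refl
σ-refl {suc j} (s≤s p) zero d = refl
σ-refl {suc j} (s≤s p) (suc k) d = σ-refl p k d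

τ-refl : ∀ {j} (p : j ≤ j) k (d : DCell j k) → τmap p k d ≡ d
τ-refl {zero} z≤n zero tt = refl
τ-refl {suc j} (s≤s p) zero d = refl
τ-refl {suc j} (s≤s p) (suc k) d = τ-refl p k d

topCell-τ-refl : ∀ {Q n} (h : GHom (D n) Q) (p : n ≤ n) → topCell (h ∘G τ p) ≡ topCell h
topCell-τ-refl {n = n} h p = cong (map h n) (τ-refl p n (top n))

σ-trans : ∀ {j k i} (p : j ≤ k) (q : k ≤ i) (r : j ≤ i) m (d : DCell j m) →
          σmap q m (σmap p m d) ≡ σmap r m d
σ-trans {i = zero} z≤n z≤n z≤n zero tt = refl
σ-trans {k = zero} {i = suc i} z≤n z≤n z≤n zero tt = refl
σ-trans {k = suc k} {i = suc i} z≤n (s≤s q) z≤n zero tt = refl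
σ-trans (s≤s p) (s≤s q) (s≤s r) zero d = refl
σ-trans (s≤s p) (s≤s q) (s≤s r) (suc m) d = σ-trans p q r m d

τ-trans : ∀ {j k i} (p : j ≤ k) (q : k ≤ i) (r : j ≤ i) m (d : DCell j m) →
          τmap q m (τmap p m d) ≡ τmap r m d
τ-trans {i = zero} z≤n z≤n z≤n zero tt = refl
τ-trans {k = zero} {i = suc i} z≤n z≤n z≤n zero tt = refl
τ-trans {k = suc k} {i = suc i} z≤n (s≤s q) z≤n zero tt = refl
τ-trans (s≤s p) (s≤s q) (s≤s r) zero d = refl
τ-trans (s≤s p) (s≤s q) (s≤s r) (suc m) d = τ-trans p q r m d

σ-τ-trans : ∀ {j k i} (p : j ≤ k) (q : k ≤ i) (r : j ≤ i) → j < k → ∀ m (d : DCell j m) →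
            σmap q m (τmap p m d) ≡ τmap r m d
σ-τ-trans {i = suc i} z≤n (s≤s q) z≤n (s≤s z≤n) zero tt = refl
σ-τ-trans (s≤s p) (s≤s q) (s≤s r) j<k zero d = refl
σ-τ-trans (s≤s p) (s≤s q) (s≤s r) (s≤s j<k) (suc m) d = σ-τ-trans p q r j<k m d

σ-irrelevant : ∀ {j i} (p p′ : j ≤ i) k (x : DCell j k) → σmap p k x ≡ σmap p′ k x
σ-irrelevant p p′ k x rewrite ≤-irrelevant p p′ = refl

-- Pushouts along σ, and gluing a cell

record Pushout (G : GSet) {j i : ℕ} (p : j ≤ i) (h : GHom (D j) G) (P : GSet) : Set₁ where
  field
    incl   : GHom G P
    glued  : GHom (D i) P
    square : (incl ∘G h) ≈G (glued ∘G σ p)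
    factor : (Q : GSet) (a : GHom G Q) (b : GHom (D i) Q) → (a ∘G h) ≈G (b ∘G σ p) →
             Σ[ u ∈ GHom P Q ] ((u ∘G incl) ≈G a × (u ∘G glued) ≈G b)
    unique : (Q : GSet) (u u′ : GHom P Q) →
             (u ∘G incl) ≈G (u′ ∘G incl) → (u ∘G glued) ≈G (u′ ∘G glued) → u ≈G u′
open Pushout public

Pushout-cast : ∀ {G j i} {p p′ : j ≤ i} {h P} → Pushout G p h P → Pushout G p′ h P
Pushout-cast {p = p} {p′} po = record
  { incl = incl po ; glued = glued po
  ; square = λ k x → trans (square po k x) (cong (map (glued po) k) (σ-irrelevant p p′ k x))
  ; factor = λ Q a b e → factor po Q a b (λ k x → trans (e k x) (cong (map b k) (σ-irrelevant p′ p k x)))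
  ; unique = unique po }

Pushout-refl : ∀ {G j} (p : j ≤ j) (h : GHom (D j) G) → Pushout G p h G
Pushout-refl p h = record
  { incl = idG ; glued = h
  ; square = λ k d → cong (map h k) (sym (σ-refl p k d))
  ; factor = λ Q a b e → a , (λ _ _ → refl) , (λ k d → trans (e k d) (cong (map b k) (σ-refl p k d)))
  ; unique = λ Q u u′ e₁ e₂ → e₁ }

Pushout-paste : ∀ {G P P′ j k i} {p : j ≤ k} {q : k ≤ i} {h : GHom (D j) G} →
                (po : Pushout G p h P) → Pushout P q (glued po) P′ → Pushout G (≤-trans p q) h P′
Pushout-paste {p = p} {q} {h} po po′ = record
  { incl = incl po′ ∘G incl po ; glued = glued po′
  ; square = λ m d → trans (cong (map (incl po′) m) (square po m d))
                       (trans (square po′ m (σmap p m d)) (cong (map (glued po′) m) (σ-pq m d)))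
  ; factor = λ Q a b e →
      let (u , ua , ub) = factor po Q a (b ∘G σ q) (λ m d → trans (e m d) (cong (map b m) (sym (σ-pq m d))))
          (u′ , u′u , u′b) = factor po′ Q u b ub
      in u′ , (λ m x → trans (u′u m (map (incl po) m x)) (ua m x)) , u′b
  ; unique = λ Q u u′ e₁ e₂ →
      unique po′ Q u u′
        (unique po Q (u ∘G incl po′) (u′ ∘G incl po′) e₁
           (λ m d → trans (cong (map u m) (square po′ m d))
                      (trans (e₂ m (σmap q m d)) (cong (map u′ m) (sym (square po′ m d))))))
        e₂ }
  where
  σ-pq : ∀ m d → σmap q m (σmap p m d) ≡ σmap (≤-trans p q) m d
  σ-pq = σ-trans p q (≤-trans p q)

-- Glue G n c is G with a new n-cell y parallel to c and a new (n+1)-cell f : c → y.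
data Added (n : ℕ) : ℕ → Set where
  new-y : Added n n
  new-f : Added n (suc n)

GlueCell : (G : GSet) (n : ℕ) → ℕ → Set
GlueCell G n k = Cell G k ⊎ Added n k

glueSrc glueTgt : (G : GSet) (n : ℕ) → Cell G n → ∀ k → GlueCell G n (suc k) → GlueCell G n k
glueSrc G n c k (inj₁ x) = inj₁ (src G k x)
glueSrc G .(suc k) c k (inj₂ new-y) = inj₁ (src G k c)
glueSrc G .k c k (inj₂ new-f) = inj₁ c
glueTgt G n c k (inj₁ x) = inj₁ (tgt G k x)
glueTgt G .(suc k) c k (inj₂ new-y) = inj₁ (tgt G k c)
glueTgt G .k c k (inj₂ new-f) = inj₂ new-y

Glue : (G : GSet) (n : ℕ) → Cell G n → GSet
Glue G n c = record
  { Cell = GlueCell G n ; src = glueSrc G n c ; tgt = glueTgt G n c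
  ; glob-s = glob-s′ ; glob-t = glob-t′ }
  where
  glob-s′ : ∀ k (x : GlueCell G n (suc (suc k))) →
            glueSrc G n c k (glueSrc G n c (suc k) x) ≡ glueSrc G n c k (glueTgt G n c (suc k) x)
  glob-s′ k (inj₁ x) = cong inj₁ (glob-s G k x)
  glob-s′ k (inj₂ new-y) = cong inj₁ (glob-s G k c)
  glob-s′ k (inj₂ new-f) = refl
  glob-t′ : ∀ k (x : GlueCell G n (suc (suc k))) →
            glueTgt G n c k (glueSrc G n c (suc k) x) ≡ glueTgt G n c k (glueTgt G n c (suc k) x)
  glob-t′ k (inj₁ x) = cong inj₁ (glob-t G k x)
  glob-t′ k (inj₂ new-y) = cong inj₁ (glob-t G k c)
  glob-t′ k (inj₂ new-f) = refl

module _ (G : GSet) (n : ℕ) (c : Cell G n) where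
  glueIncl : GHom G (Glue G n c)
  glueIncl = record { map = λ _ → inj₁ ; map-s = λ _ _ → refl ; map-t = λ _ _ → refl }

  newDisk : GHom (D (suc n)) (Glue G n c)
  newDisk = diskMap (Glue G n c) (suc n) (inj₂ new-f)

  newDisk-top : topCell newDisk ≡ inj₂ new-f
  newDisk-top = diskCell-top (Glue G n c) (suc n) (inj₂ new-f)

  newDisk-σ : (q : n ≤ suc n) → topCell (newDisk ∘G σ q) ≡ inj₁ c
  newDisk-σ q =
    trans (cong (map newDisk n) (σ-top n q))
      (trans (map-s newDisk n (top (suc n))) (cong (glueSrc G n c n) newDisk-top))

  newDisk-τ : (q : n ≤ suc n) → topCell (newDisk ∘G τ q) ≡ inj₂ new-y
  newDisk-τ q =
    trans (cong (map newDisk n) (τ-top n q))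
      (trans (map-t newDisk n (top (suc n))) (cong (glueTgt G n c n) newDisk-top))

module GluePushout (G : GSet) (n : ℕ) (h : GHom (D n) G) (p : n ≤ suc n) where
  private
    c : Cell G n
    c = topCell h

  module Factor (Q : GSet) (a : GHom G Q) (b : GHom (D (suc n)) Q) (e : (a ∘G h) ≈G (b ∘G σ p)) where
    cells : ∀ k → GlueCell G n k → Cell Q k
    cells k (inj₁ x) = map a k x
    cells .n (inj₂ new-y) = map b n (Dtgt (suc n) n (top (suc n)))
    cells .(suc n) (inj₂ new-f) = map b (suc n) (top (suc n))

    cells-src : ∀ k (x : GlueCell G n (suc k)) → cells k (glueSrc G n c k x) ≡ src Q k (cells (suc k) x)
    cells-src k (inj₁ x) = map-s a k x
    cells-src k (inj₂ new-y) =
      trans (cong (map a k) (sym (map-s h k (top (suc k)))))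
        (trans (e k _)
          (trans (cong (map b k) (trans (σmap-s p k (top (suc k))) (Dsrc-const (suc (suc k)) k _ _)))
                 (map-s b k _)))
    cells-src k (inj₂ new-f) = trans (e k (top k)) (trans (cong (map b k) (σ-top k p)) (map-s b k (top (suc k))))

    cells-tgt : ∀ k (x : GlueCell G n (suc k)) → cells k (glueTgt G n c k x) ≡ tgt Q k (cells (suc k) x)
    cells-tgt k (inj₁ x) = map-t a k x
    cells-tgt k (inj₂ new-y) =
      trans (cong (map a k) (sym (map-t h k (top (suc k)))))
        (trans (e k _)
          (trans (cong (map b k) (trans (σmap-t p k (top (suc k))) (Dtgt-const (suc (suc k)) k _ _)))
                 (map-t b k _)))
    cells-tgt k (inj₂ new-f) = map-t b k (top (suc k))

    mediator : GHom (Glue G n c) Q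
    mediator = record { map = cells ; map-s = cells-src ; map-t = cells-tgt }

  unique-mediator : (Q : GSet) (u u′ : GHom (Glue G n c) Q) →
                    (u ∘G glueIncl G n c) ≈G (u′ ∘G glueIncl G n c) →
                    (u ∘G newDisk G n c) ≈G (u′ ∘G newDisk G n c) → u ≈G u′
  unique-mediator Q u u′ e₁ e₂ k (inj₁ x) = e₁ k x
  unique-mediator Q u u′ e₁ e₂ .n (inj₂ new-y) =
    subst (λ z → map u n z ≡ map u′ n z) (newDisk-τ G n c (n≤1+n n)) (e₂ n (τmap (n≤1+n n) n (top n)))
  unique-mediator Q u u′ e₁ e₂ .(suc n) (inj₂ new-f) =
    subst (λ z → map u (suc n) z ≡ map u′ (suc n) z) (newDisk-top G n c) (e₂ (suc n) (top (suc n)))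

  gluePushout : Pushout G p h (Glue G n c)
  gluePushout = record
    { incl = glueIncl G n c ; glued = newDisk G n c
    ; square = ≈G-topCell (glueIncl G n c ∘G h) (newDisk G n c ∘G σ p) (sym (newDisk-σ G n c p))
    ; factor = λ Q a b e → let open Factor Q a b e in
        mediator , (λ _ _ → refl) ,
        ≈G-topCell (mediator ∘G newDisk G n c) b (cong (cells (suc n)) (newDisk-top G n c))
    ; unique = unique-mediator }

open GluePushout using (gluePushout)

-- Colimits

colimit-endo≈id : ∀ {Z X} {c : Cocone Z X} → IsColimit Z X c →
                  (e : GHom X X) → (∀ m → (e ∘G leg c m) ≈G leg c m) → e ≈G idG
colimit-endo≈id {X = X} {c} colim e e-legs k x with colim X c
... | _ , _ , unique-factor = trans (unique-factor e e-legs k x) (sym (unique-factor idG (λ _ _ _ → refl) k x))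

colimit-unique : ∀ {Z P S} {cP : Cocone Z P} {cS : Cocone Z S} → IsColimit Z P cP → IsColimit Z S cS →
                 Σ[ u ∈ GHom P S ] Σ[ v ∈ GHom S P ] ((v ∘G u) ≈G idG × (u ∘G v) ≈G idG)
colimit-unique {P = P} {S} {cP} {cS} colP colS with colP S cS | colS P cP
... | u , u-legs , _ | v , v-legs , _ =
  u , v ,
  colimit-endo≈id {c = cP} colP (v ∘G u) (λ m k x → trans (cong (map v k) (u-legs m k x)) (v-legs m k x)) ,
  colimit-endo≈id {c = cS} colS (u ∘G v) (λ m k x → trans (cong (map u k) (v-legs m k x)) (u-legs m k x))

private
  transport-face : ∀ {A₁ A B₁ B : Set} {R : B₁ → B → Set} (f₁ : A₁ → B₁) (f : A → B) (g : B → A) →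
                   (∀ x → g (f x) ≡ x) → (op : A₁ → A) (op′ : B₁ → B) → (∀ c → f (op c) ≡ op′ (f₁ c)) →
                   (∀ c d → (d ≡ op′ c) ⇔ R c d) → ∀ c d → (d ≡ op c) ⇔ R (f₁ c) (f d)
  transport-face f₁ f g gf op op′ f-op face c d = mk⇔
    (λ d≡ → Equivalence.to (face (f₁ c) (f d)) (trans (cong f d≡) (f-op c)))
    (λ r → trans (sym (gf d))
             (trans (cong g (trans (Equivalence.from (face _ _) r) (sym (f-op c)))) (gf (op c))))

≅GΓ-transport : ∀ {P S Γ} (u : GHom P S) (v : GHom S P) → (v ∘G u) ≈G idG → (u ∘G v) ≈G idG →
                S ≅GΓ Γ → P ≅GΓ Γ
≅GΓ-transport {P} {S} {Γ} u v vu uv iso = record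
  { bij = λ k → mk↔ₛ′ (to (bij k) ∘ map u k) (map v k ∘ from (bij k))
                  (λ g → trans (cong (to (bij k)) (uv k _)) (strictlyInverseˡ (bij k) g))
                  (λ z → trans (cong (map v k) (strictlyInverseʳ (bij k) (map u k z))) (vu k z))
  ; src≅ = λ k → transport-face (map u (suc k)) (map u k) (map v k) (vu k) (src P k) (src S k) (map-s u k) (src≅ k)
  ; tgt≅ = λ k → transport-face (map u (suc k)) (map u k) (map v k) (vu k) (tgt P k) (tgt S k) (map-t u k) (tgt≅ k)
  }
  where open _≅GΓ_ iso

-- The globular set of a context

injL : (Γ Δ : Ctx) → Fin (length Γ) → Fin (length (Γ ++ Δ))
injL (_ ∷ Γ) Δ zero = zero
injL (_ ∷ Γ) Δ (fsuc e) = fsuc (injL Γ Δ e)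

injR : (Γ Δ : Ctx) → Fin (length Δ) → Fin (length (Γ ++ Δ))
injR [] Δ e = e
injR (_ ∷ Γ) Δ e = fsuc (injR Γ Δ e)

lookup-injL : ∀ Γ Δ e → lookup (Γ ++ Δ) (injL Γ Δ e) ≡ lookup Γ e
lookup-injL (_ ∷ Γ) Δ zero = refl
lookup-injL (_ ∷ Γ) Δ (fsuc e) = lookup-injL Γ Δ e

lookup-injR : ∀ Γ Δ e → lookup (Γ ++ Δ) (injR Γ Δ e) ≡ lookup Δ e
lookup-injR [] Δ e = refl
lookup-injR (_ ∷ Γ) Δ e = lookup-injR Γ Δ e

data Split++ (Γ Δ : Ctx) : Fin (length (Γ ++ Δ)) → Set where
  left  : (e : Fin (length Γ)) → Split++ Γ Δ (injL Γ Δ e)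
  right : (e : Fin (length Δ)) → Split++ Γ Δ (injR Γ Δ e)

split++ : ∀ Γ Δ (e : Fin (length (Γ ++ Δ))) → Split++ Γ Δ e
split++ [] Δ e = right e
split++ (_ ∷ Γ) Δ zero = left zero
split++ (_ ∷ Γ) Δ (fsuc e) with split++ Γ Δ e
... | left e′ = left (fsuc e′)
... | right e′ = right e′

split++-injL : ∀ Γ Δ e → split++ Γ Δ (injL Γ Δ e) ≡ left e
split++-injL (_ ∷ Γ) Δ zero = refl
split++-injL (_ ∷ Γ) Δ (fsuc e) rewrite split++-injL Γ Δ e = refl

split++-injR : ∀ Γ Δ e → split++ Γ Δ (injR Γ Δ e) ≡ right e
split++-injR [] Δ e = refl
split++-injR (_ ∷ Γ) Δ e rewrite split++-injR Γ Δ e = refl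

GΓCell-≡ : ∀ Γ {k} {e₁ e₂ : Fin (length Γ)} {p₁ p₂} → e₁ ≡ e₂ →
           _≡_ {A = GΓCell Γ k} (e₁ , p₁) (e₂ , p₂)
GΓCell-≡ Γ {p₁ = p₁} {p₂} refl = cong (_ ,_) (≡-irrelevant p₁ p₂)

GΓCell-++ : ∀ Γ Δ k → (GΓCell Γ k ⊎ GΓCell Δ k) ↔ GΓCell (Γ ++ Δ) k
GΓCell-++ Γ Δ k = mk↔ₛ′ join split join∘split split∘join
  where
  entryDim : Var × Ty → ℕ
  entryDim = dim ∘ proj₂

  join : GΓCell Γ k ⊎ GΓCell Δ k → GΓCell (Γ ++ Δ) k
  join (inj₁ (e , p)) = injL Γ Δ e , trans (cong entryDim (lookup-injL Γ Δ e)) p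
  join (inj₂ (e , p)) = injR Γ Δ e , trans (cong entryDim (lookup-injR Γ Δ e)) p

  split′ : ∀ e → dim (entryTy (Γ ++ Δ) e) ≡ k → Split++ Γ Δ e → GΓCell Γ k ⊎ GΓCell Δ k
  split′ _ p (left e) = inj₁ (e , trans (sym (cong entryDim (lookup-injL Γ Δ e))) p)
  split′ _ p (right e) = inj₂ (e , trans (sym (cong entryDim (lookup-injR Γ Δ e))) p)

  split : GΓCell (Γ ++ Δ) k → GΓCell Γ k ⊎ GΓCell Δ k
  split (e , p) = split′ e p (split++ Γ Δ e)

  join∘split : ∀ g → join (split g) ≡ g
  join∘split (e , p) with split++ Γ Δ e
  ... | left _ = GΓCell-≡ (Γ ++ Δ) refl
  ... | right _ = GΓCell-≡ (Γ ++ Δ) refl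

  split∘join : ∀ z → split (join z) ≡ z
  split∘join (inj₁ (e , p)) rewrite split++-injL Γ Δ e = cong inj₁ (GΓCell-≡ Γ refl)
  split∘join (inj₂ (e , p)) rewrite split++-injR Γ Δ e = cong inj₂ (GΓCell-≡ Δ refl)

extension : Var → Ty → Var → Var → Ctx
extension x A y f = (y , A) ∷ (f , Hom A x y) ∷ []

Added-↔ : ∀ {n k x A y f} → dim A ≡ n → Added n k ↔ GΓCell (extension x A y f) k
Added-↔ {n} {x = x} {A} {y} {f} dimA = mk↔ₛ′ toCell fromCell to∘from from∘to
  where
  toCell : ∀ {k} → Added n k → GΓCell (extension x A y f) k
  toCell new-y = zero , dimA
  toCell new-f = fsuc zero , cong suc dimA

  y-at : ∀ {k} → n ≡ k → Added n k
  y-at refl = new-y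

  f-at : ∀ {k} → suc n ≡ k → Added n k
  f-at refl = new-f

  fromCell : ∀ {k} → GΓCell (extension x A y f) k → Added n k
  fromCell (zero , p) = y-at (trans (sym dimA) p)
  fromCell (fsuc zero , p) = f-at (trans (cong suc (sym dimA)) p)

  to∘y-at : ∀ {k} (eq : n ≡ k) p → toCell (y-at eq) ≡ (zero , p)
  to∘y-at refl p = GΓCell-≡ (extension x A y f) refl

  to∘f-at : ∀ {k} (eq : suc n ≡ k) p → toCell (f-at eq) ≡ (fsuc zero , p)
  to∘f-at refl p = GΓCell-≡ (extension x A y f) refl

  to∘from : ∀ g → toCell (fromCell g) ≡ g
  to∘from (zero , p) = to∘y-at _ p
  to∘from (fsuc zero , p) = to∘f-at _ p

  from∘to : ∀ a → fromCell (toCell a) ≡ a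
  from∘to new-y rewrite ≡-irrelevant (trans (sym dimA) dimA) refl = refl
  from∘to new-f rewrite ≡-irrelevant (trans (cong suc (sym dimA)) (cong suc dimA)) refl = refl

module _ {P : GSet} {Γ : Ctx} (iso : P ≅GΓ Γ) where
  open _≅GΓ_ iso

  index : ∀ k → Cell P k → Fin (length Γ)
  index k s = proj₁ (to (bij k) s)

  entry : ∀ k → Cell P k → Var × Ty
  entry k s = lookup Γ (index k s)

  entry-dim : ∀ k s → dim (proj₂ (entry k s)) ≡ k
  entry-dim k s = proj₂ (to (bij k) s)

  index-injective : ∀ k {s s′} → index k s ≡ index k s′ → s ≡ s′
  index-injective k {s} {s′} eq =
    trans (sym (strictlyInverseʳ (bij k) s))
      (trans (cong (from (bij k)) (GΓCell-≡ Γ eq)) (strictlyInverseʳ (bij k) s′))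

-- GΓSrc Γ n (e , _) (e′ , _) unfolds to IsSrc (entryTy Γ e) (entryVar Γ e′), and likewise for targets.
IsSrc IsTgt : Ty → Var → Set
IsSrc A v = Σ[ B ∈ Ty ] Σ[ u ∈ Var ] Σ[ w ∈ Var ] (A ≡ Hom B u w × v ≡ u)
IsTgt A v = Σ[ B ∈ Ty ] Σ[ u ∈ Var ] Σ[ w ∈ Var ] (A ≡ Hom B u w × v ≡ w)

IsSrc-Hom : ∀ {B u w v} → IsSrc (Hom B u w) v ⇔ v ≡ u
IsSrc-Hom = mk⇔ (λ { (_ , _ , _ , refl , eq) → eq }) (λ eq → _ , _ , _ , refl , eq)

IsTgt-Hom : ∀ {B u w v} → IsTgt (Hom B u w) v ⇔ v ≡ w
IsTgt-Hom = mk⇔ (λ { (_ , _ , _ , refl , eq) → eq }) (λ eq → _ , _ , _ , refl , eq)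

module _ {v : Var} {Γ : Ctx} (fresh : Fresh v Γ) (e : Fin (length Γ)) where
  private
    fresh-entry : ¬ OccEntry v (lookup Γ e)
    fresh-entry = fresh ∘ lose (∈-lookup e)

  fresh-entryVar : entryVar Γ e ≢ v
  fresh-entryVar eq = fresh-entry (inj₁ (sym eq))

  fresh-¬IsSrc : ¬ IsSrc (entryTy Γ e) v
  fresh-¬IsSrc (_ , _ , _ , eq , refl) = fresh-entry (inj₂ (subst (OccTy v) (sym eq) (inj₁ (inj₁ refl))))

  fresh-¬IsTgt : ¬ IsTgt (entryTy Γ e) v
  fresh-¬IsTgt (_ , _ , _ , eq , refl) = fresh-entry (inj₂ (subst (OccTy v) (sym eq) (inj₁ (inj₂ refl))))

DistinctVars : Ctx → Set
DistinctVars Γ = ∀ e e′ → entryVar Γ e ≡ entryVar Γ e′ → e ≡ e′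

inj₁-⇔ : ∀ {A B : Set} {a a′ : A} → (_≡_ {A = A ⊎ B} (inj₁ a) (inj₁ a′)) ⇔ (a ≡ a′)
inj₁-⇔ = mk⇔ inj₁-injective (cong inj₁)

module _ {S : GSet} {Γ : Ctx} (iso : S ≅GΓ Γ) {n : ℕ} (c : Cell S n) {x : Var} {A : Ty}
         (c-entry : entry iso n c ≡ (x , A)) {y f : Var} where
  open _≅GΓ_ iso

  glueEntry : ∀ k → GlueCell S n k → Var × Ty
  glueEntry k (inj₁ s) = entry iso k s
  glueEntry .n (inj₂ new-y) = y , A
  glueEntry .(suc n) (inj₂ new-f) = f , Hom A x y

  private
    Γ⁺ : Ctx
    Γ⁺ = Γ ++ extension x A y f

    bij⁺ : ∀ k → GlueCell S n k ↔ GΓCell Γ⁺ k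
    bij⁺ k = GΓCell-++ Γ (extension x A y f) k ↔-∘
             (bij k ⊎-↔ Added-↔ (trans (cong (dim ∘ proj₂) (sym c-entry)) (entry-dim iso n c)))

    lookup-bij⁺ : ∀ k z → lookup Γ⁺ (proj₁ (to (bij⁺ k) z)) ≡ glueEntry k z
    lookup-bij⁺ k (inj₁ s) = lookup-injL Γ _ (index iso k s)
    lookup-bij⁺ .n (inj₂ new-y) = lookup-injR Γ _ zero
    lookup-bij⁺ .(suc n) (inj₂ new-f) = lookup-injR Γ _ (fsuc zero)

  module _ (distinct : DistinctVars Γ) (fresh-y : Fresh y Γ) (fresh-f : Fresh f Γ) where
    private
      ≡c-⇔ : ∀ {s} → (s ≡ c) ⇔ (proj₁ (entry iso n s) ≡ x)
      ≡c-⇔ {s} = mk⇔ (λ { refl → cong proj₁ c-entry })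
                     (λ eq → index-injective iso n (distinct _ _ (trans eq (sym (cong proj₁ c-entry)))))

      y≢x : y ≢ x
      y≢x y≡x = fresh-entryVar fresh-y (index iso n c) (trans (cong proj₁ c-entry) (sym y≡x))

      both-false : ∀ {P Q : Set} → ¬ P → ¬ Q → P ⇔ Q
      both-false ¬p ¬q = mk⇔ (⊥-elim ∘ ¬p) (⊥-elim ∘ ¬q)

      glue-src : ∀ k cc dd →
                 (dd ≡ glueSrc S n c k cc) ⇔ IsSrc (proj₂ (glueEntry (suc k) cc)) (proj₁ (glueEntry k dd))
      glue-src k (inj₁ s′) (inj₁ s) = src≅ k s′ s ⇔-∘ inj₁-⇔
      glue-src k (inj₁ s′) (inj₂ new-y) = both-false (λ ()) (fresh-¬IsSrc fresh-y (index iso (suc k) s′))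
      glue-src k (inj₁ s′) (inj₂ new-f) = both-false (λ ()) (fresh-¬IsSrc fresh-f (index iso (suc k) s′))
      glue-src k (inj₂ new-y) (inj₁ s) =
        subst (λ a → _ ⇔ IsSrc (proj₂ a) (proj₁ (entry iso k s))) c-entry (src≅ k c s ⇔-∘ inj₁-⇔)
      glue-src k (inj₂ new-f) (inj₁ s) = ⇔-sym IsSrc-Hom ⇔-∘ (≡c-⇔ ⇔-∘ inj₁-⇔)
      glue-src k (inj₂ new-f) (inj₂ new-y) = both-false (λ ()) (y≢x ∘ Equivalence.to IsSrc-Hom)

      glue-tgt : ∀ k cc dd →
                 (dd ≡ glueTgt S n c k cc) ⇔ IsTgt (proj₂ (glueEntry (suc k) cc)) (proj₁ (glueEntry k dd))
      glue-tgt k (inj₁ s′) (inj₁ s) = tgt≅ k s′ s ⇔-∘ inj₁-⇔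
      glue-tgt k (inj₁ s′) (inj₂ new-y) = both-false (λ ()) (fresh-¬IsTgt fresh-y (index iso (suc k) s′))
      glue-tgt k (inj₁ s′) (inj₂ new-f) = both-false (λ ()) (fresh-¬IsTgt fresh-f (index iso (suc k) s′))
      glue-tgt k (inj₂ new-y) (inj₁ s) =
        subst (λ a → _ ⇔ IsTgt (proj₂ a) (proj₁ (entry iso k s))) c-entry (tgt≅ k c s ⇔-∘ inj₁-⇔)
      glue-tgt k (inj₂ new-f) (inj₁ s) =
        both-false (λ ()) (fresh-entryVar fresh-y (index iso k s) ∘ Equivalence.to IsTgt-Hom)
      glue-tgt k (inj₂ new-f) (inj₂ new-y) = mk⇔ (λ _ → Equivalence.from IsTgt-Hom refl) (λ _ → refl)

    glueIso : Glue S n c ≅GΓ Γ⁺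
    glueIso = record
      { bij = bij⁺
      ; src≅ = λ k cc dd → subst₂ (λ a b → _ ⇔ IsSrc a b) (sym (ty (suc k) cc)) (sym (var k dd)) (glue-src k cc dd)
      ; tgt≅ = λ k cc dd → subst₂ (λ a b → _ ⇔ IsTgt a b) (sym (ty (suc k) cc)) (sym (var k dd)) (glue-tgt k cc dd)
      }
      where
      ty : ∀ k z → proj₂ (lookup Γ⁺ (proj₁ (to (bij⁺ k) z))) ≡ proj₂ (glueEntry k z)
      ty k z = cong proj₂ (lookup-bij⁺ k z)
      var : ∀ k z → proj₁ (lookup Γ⁺ (proj₁ (to (bij⁺ k) z))) ≡ proj₁ (glueEntry k z)
      var k z = cong proj₁ (lookup-bij⁺ k z)

    entry-glueIso : ∀ k z → entry glueIso k z ≡ glueEntry k z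
    entry-glueIso = lookup-bij⁺

DistinctVars-++ : ∀ Γ Δ → DistinctVars Γ → DistinctVars Δ →
                  (∀ e e′ → entryVar Γ e ≢ entryVar Δ e′) → DistinctVars (Γ ++ Δ)
DistinctVars-++ Γ Δ distinctΓ distinctΔ apart e₁ e₂ = by-cases (split++ Γ Δ e₁) (split++ Γ Δ e₂)
  where
  var-L : ∀ e → entryVar (Γ ++ Δ) (injL Γ Δ e) ≡ entryVar Γ e
  var-L e = cong proj₁ (lookup-injL Γ Δ e)

  var-R : ∀ e → entryVar (Γ ++ Δ) (injR Γ Δ e) ≡ entryVar Δ e
  var-R e = cong proj₁ (lookup-injR Γ Δ e)

  by-cases : ∀ {e₁ e₂} → Split++ Γ Δ e₁ → Split++ Γ Δ e₂ →
             entryVar (Γ ++ Δ) e₁ ≡ entryVar (Γ ++ Δ) e₂ → e₁ ≡ e₂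
  by-cases (left a) (left b) eq = cong (injL Γ Δ) (distinctΓ a b (trans (sym (var-L a)) (trans eq (var-L b))))
  by-cases (left a) (right b) eq = ⊥-elim (apart a b (trans (sym (var-L a)) (trans eq (var-R b))))
  by-cases (right a) (left b) eq = ⊥-elim (apart b a (trans (sym (var-L b)) (trans (sym eq) (var-R a))))
  by-cases (right a) (right b) eq = cong (injR Γ Δ) (distinctΔ a b (trans (sym (var-R a)) (trans eq (var-R b))))

DistinctVars-extend : ∀ {Γ x A y f} → DistinctVars Γ → Fresh y Γ → Fresh f Γ → y ≢ f →
                      DistinctVars (Γ ++ extension x A y f)
DistinctVars-extend {Γ} distinct fresh-y fresh-f y≢f =
  DistinctVars-++ Γ _ distinct distinct-yf apart
  where
  distinct-yf : DistinctVars (extension _ _ _ _)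
  distinct-yf zero zero _ = refl
  distinct-yf zero (fsuc zero) eq = ⊥-elim (y≢f eq)
  distinct-yf (fsuc zero) zero eq = ⊥-elim (y≢f (sym eq))
  distinct-yf (fsuc zero) (fsuc zero) _ = refl

  apart : ∀ e e′ → entryVar Γ e ≢ entryVar (extension _ _ _ _) e′
  apart e zero = fresh-entryVar fresh-y e
  apart e (fsuc zero) = fresh-entryVar fresh-f e

point≅ : ∀ x → D 0 ≅GΓ ((x , ⋆) ∷ [])
point≅ x = record { bij = cells ; src≅ = λ _ () ; tgt≅ = λ _ () }
  where
  cells : ∀ k → DCell 0 k ↔ GΓCell ((x , ⋆) ∷ []) k
  cells zero = mk↔ₛ′ (λ _ → zero , refl) (λ _ → tt)
                     (λ { (zero , _) → GΓCell-≡ ((x , ⋆) ∷ []) refl }) (λ _ → refl)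
  cells (suc k) = mk↔ₛ′ (λ ()) (λ { (zero , ()) }) (λ { (zero , ()) }) (λ ())

∈-insert⁺ : ∀ (Δa Δb : Ctx) {a p} → p ∈ Δa ++ Δb → p ∈ Δa ++ a ∷ Δb
∈-insert⁺ Δa Δb m = ∈-resp-↭ (↭-sym (↭-shift Δa Δb)) (there m)

∈-insert⁻ : ∀ (Δa Δb : Ctx) {a p} → p ∈ Δa ++ a ∷ Δb → p ≢ a → p ∈ Δa ++ Δb
∈-insert⁻ Δa Δb m p≢a with ∈-resp-↭ (↭-shift Δa Δb) m
... | here p≡a = ⊥-elim (p≢a p≡a)
... | there m′ = m′

Unique-insert⁻ : ∀ (Δa Δb : Ctx) {a} → Unique (Δa ++ a ∷ Δb) → All (a ≢_) (Δa ++ Δb) × Unique (Δa ++ Δb)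
Unique-insert⁻ Δa Δb u with Unique-resp-↭ (↭-shift Δa Δb) u
... | a≢ ∷ u′ = a≢ , u′

module _ (Δa Δb E : Ctx) {p : Var × Ty} where
  ∈-appended⁺ˡ : p ∈ Δa ++ Δb → p ∈ Δa ++ Δb ++ E
  ∈-appended⁺ˡ m = subst (p ∈_) (++-assoc Δa Δb E) (∈-++⁺ˡ m)

  ∈-appended⁺ʳ : p ∈ E → p ∈ Δa ++ Δb ++ E
  ∈-appended⁺ʳ m = subst (p ∈_) (++-assoc Δa Δb E) (∈-++⁺ʳ (Δa ++ Δb) m)

  ∈-appended⁻ : p ∈ Δa ++ Δb ++ E → p ∈ Δa ++ Δb ⊎ p ∈ E
  ∈-appended⁻ m = ∈-++⁻ (Δa ++ Δb) (subst (p ∈_) (sym (++-assoc Δa Δb E)) m)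

-- Zigzags as lists, and inserting a disk at a slot

data ZigList : ℕ → Set where
  single : (n : ℕ) → ZigList n
  cons   : (a b : ℕ) {c : ℕ} → b ≤ a → b ≤ c → ZigList c → ZigList a

size : ∀ {a} → ZigList a → ℕ
size (single n) = 0
size (cons a b p q L) = suc (size L)

disks : ∀ {a} (L : ZigList a) → Fin (suc (size L)) → ℕ
disks {a} L zero = a
disks (cons a b p q L) (fsuc m) = disks L m

joins : ∀ {a} (L : ZigList a) → Fin (size L) → ℕ
joins (cons a b p q L) zero = b
joins (cons a b p q L) (fsuc m) = joins L m

joins≤left : ∀ {a} (L : ZigList a) m → joins L m ≤ disks L (inject₁ m)
joins≤left (cons a b p q L) zero = p
joins≤left (cons a b p q L) (fsuc m) = joins≤left L m

joins≤right : ∀ {a} (L : ZigList a) m → joins L m ≤ disks L (fsuc m)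
joins≤right (cons a b p q L) zero = q
joins≤right (cons a b p q L) (fsuc m) = joins≤right L m

toZigzag : ∀ {a} → ZigList a → Zigzag
toZigzag L = record { len = size L ; i = disks L ; j = joins L ; j≤il = joins≤left L ; j≤ir = joins≤right L }

singleCocone : ∀ {n Q} → GHom (D n) Q → Cocone (toZigzag (single n)) Q
singleCocone l = record { leg = λ { zero → l } ; commut = λ () }

module _ {a b c : ℕ} {p : b ≤ a} {q : b ≤ c} {L : ZigList c} {Q : GSet} where
  consCocone : (l : GHom (D a) Q) (X : Cocone (toZigzag L) Q) → (l ∘G τ p) ≈G (leg X zero ∘G σ q) →
               Cocone (toZigzag (cons a b p q L)) Q
  consCocone l X e = record
    { leg = λ { zero → l ; (fsuc m) → leg X m } ; commut = λ { zero → e ; (fsuc m) → commut X m } }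

  tailCocone : Cocone (toZigzag (cons a b p q L)) Q → Cocone (toZigzag L) Q
  tailCocone X = record { leg = leg X ∘ fsuc ; commut = commut X ∘ fsuc }

mapCocone : ∀ {Z Q Q′} → GHom Q Q′ → Cocone Z Q → Cocone Z Q′
mapCocone ι X = record { leg = λ m → ι ∘G leg X m ; commut = λ m k x → cong (map ι k) (commut X m k x) }

-- A slot of dimension d is a target d-face of a disk of L that is not glued to the next disk; in
-- the colimit these are the cells to which the extension rule of ⊢ps may attach a (d+1)-cell.
data Slot : ∀ {a} → ZigList a → ℕ → Set where
  slot-single : ∀ {n d} → d ≤ n → Slot (single n) d
  slot-here   : ∀ {a b c d} {p : b ≤ a} {q : b ≤ c} {L : ZigList c} → d ≤ a → b < d → Slot (cons a b p q L) d
  slot-there  : ∀ {a b c d} {p : b ≤ a} {q : b ≤ c} {L : ZigList c} → Slot L d → Slot (cons a b p q L) d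

slotDisk : ∀ {a d} {L : ZigList a} → Slot L d → Fin (suc (size L))
slotDisk (slot-single _) = zero
slotDisk (slot-here _ _) = zero
slotDisk (slot-there π) = fsuc (slotDisk π)

slotDisk≤ : ∀ {a d} {L : ZigList a} (π : Slot L d) → d ≤ disks L (slotDisk π)
slotDisk≤ (slot-single r) = r
slotDisk≤ (slot-here r _) = r
slotDisk≤ (slot-there π) = slotDisk≤ π

slotMap : ∀ {a d} {L : ZigList a} {Q} → Cocone (toZigzag L) Q → Slot L d → GHom (D d) Q
slotMap X π = leg X (slotDisk π) ∘G τ (slotDisk≤ π)

slotCell : ∀ {a d} {L : ZigList a} {Q} → Cocone (toZigzag L) Q → Slot L d → Cell Q d
slotCell X π = topCell (slotMap X π)

insert : ∀ {a d} (L : ZigList a) → Slot L d → ZigList a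
insert (single n) (slot-single {d = d} r) = cons n d r (n≤1+n d) (single (suc d))
insert (cons a b p q L) (slot-here {d = d} r b<d) =
  cons a d r (n≤1+n d) (cons (suc d) b (m<n⇒m≤1+n b<d) q L)
insert (cons a b p q L) (slot-there π) = cons a b p q (insert L π)

GluingSquare : ∀ {a d} {L : ZigList a} {Q Q′} →
               Slot L d → Cocone (toZigzag L) Q → GHom Q Q′ → GHom (D (suc d)) Q′ → Set
GluingSquare {d = d} π c ι ℓ = (ι ∘G slotMap c π) ≈G (ℓ ∘G σ (n≤1+n d))

mutual
  insertCocone : ∀ {a d} (L : ZigList a) (π : Slot L d) {Q Q′} (c : Cocone (toZigzag L) Q)
                 (ι : GHom Q Q′) (ℓ : GHom (D (suc d)) Q′) → GluingSquare π c ι ℓ →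
                 Cocone (toZigzag (insert L π)) Q′
  insertCocone (single n) (slot-single r) c ι ℓ sq = consCocone (ι ∘G leg c zero) (singleCocone ℓ) sq
  insertCocone (cons a b p q L) (slot-here {d = d} r b<d) c ι ℓ sq =
    consCocone (ι ∘G leg c zero) (consCocone ℓ (mapCocone ι (tailCocone c)) ℓ-next) sq
    where
    ℓ-next : (ℓ ∘G τ (m<n⇒m≤1+n b<d)) ≈G ((ι ∘G leg c (fsuc zero)) ∘G σ q)
    ℓ-next k x =
      trans (cong (map ℓ k) (sym (σ-τ-trans (<⇒≤ b<d) (n≤1+n d) (m<n⇒m≤1+n b<d) b<d k x)))
        (trans (sym (sq k (τmap (<⇒≤ b<d) k x)))
          (cong (map ι k) (trans (cong (map (leg c zero) k) (τ-trans (<⇒≤ b<d) r p k x)) (commut c zero k x))))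
  insertCocone (cons a b p q L) (slot-there π) c ι ℓ sq =
    consCocone (ι ∘G leg c zero) (insertCocone L π (tailCocone c) ι ℓ sq)
      (λ k x → trans (cong (map ι k) (commut c zero k x))
                     (sym (insertCocone-head L π (tailCocone c) ι ℓ sq k (σmap q k x))))

  insertCocone-head : ∀ {a d} (L : ZigList a) (π : Slot L d) {Q Q′} (c : Cocone (toZigzag L) Q)
                      (ι : GHom Q Q′) (ℓ : GHom (D (suc d)) Q′) (sq : GluingSquare π c ι ℓ) →
                      leg (insertCocone L π c ι ℓ sq) zero ≈G (ι ∘G leg c zero)
  insertCocone-head (single n) (slot-single _) c ι ℓ sq k x = refl
  insertCocone-head (cons a b p q L) (slot-here _ _) c ι ℓ sq k x = refl
  insertCocone-head (cons a b p q L) (slot-there π) c ι ℓ sq k x = refl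

mutual
  restrictCocone : ∀ {a d} (L : ZigList a) (π : Slot L d) {Q} →
                   Cocone (toZigzag (insert L π)) Q → Cocone (toZigzag L) Q
  restrictCocone (single n) (slot-single r) X = singleCocone (leg X zero)
  restrictCocone (cons a b p q L) (slot-here {d = d} r b<d) X =
    consCocone (leg X zero) (tailCocone (tailCocone X)) skip
    where
    skip : (leg X zero ∘G τ p) ≈G (leg X (fsuc (fsuc zero)) ∘G σ q)
    skip k x =
      trans (cong (map (leg X zero) k) (sym (τ-trans (<⇒≤ b<d) r p k x)))
        (trans (commut X zero k _)
          (trans (cong (map (leg X (fsuc zero)) k) (σ-τ-trans (<⇒≤ b<d) (n≤1+n d) (m<n⇒m≤1+n b<d) b<d k x))
                 (commut X (fsuc zero) k x)))
  restrictCocone (cons a b p q L) (slot-there π) X =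
    consCocone (leg X zero) (restrictCocone L π (tailCocone X))
      (λ k x → trans (commut X zero k x) (sym (restrictCocone-head L π (tailCocone X) k (σmap q k x))))

  restrictCocone-head : ∀ {a d} (L : ZigList a) (π : Slot L d) {Q} (X : Cocone (toZigzag (insert L π)) Q) →
                        leg (restrictCocone L π X) zero ≈G leg X zero
  restrictCocone-head (single n) (slot-single _) X k x = refl
  restrictCocone-head (cons a b p q L) (slot-here _ _) X k x = refl
  restrictCocone-head (cons a b p q L) (slot-there π) X k x = refl

newLeg : ∀ {a d} (L : ZigList a) (π : Slot L d) {Q} → Cocone (toZigzag (insert L π)) Q → GHom (D (suc d)) Q
newLeg (single n) (slot-single _) X = leg X (fsuc zero)
newLeg (cons a b p q L) (slot-here _ _) X = leg X (fsuc zero)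
newLeg (cons a b p q L) (slot-there π) X = newLeg L π (tailCocone X)

newLeg-square : ∀ {a d} (L : ZigList a) (π : Slot L d) {Q} (X : Cocone (toZigzag (insert L π)) Q) →
                (slotMap (restrictCocone L π X) π) ≈G (newLeg L π X ∘G σ (n≤1+n d))
newLeg-square (single n) (slot-single _) X = commut X zero
newLeg-square (cons a b p q L) (slot-here _ _) X = commut X zero
newLeg-square (cons a b p q L) (slot-there π) X = newLeg-square L π (tailCocone X)

module _ {a d} (L : ZigList a) (π : Slot L d) {Q Q′ R} (c : Cocone (toZigzag L) Q) (ι : GHom Q Q′)
         (ℓ : GHom (D (suc d)) Q′) (sq : GluingSquare π c ι ℓ) (X : Cocone (toZigzag (insert L π)) R)
         (u : GHom Q′ R) where
  FactorsOld FactorsNew FactorsInserted : Set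
  FactorsOld = ∀ m → (u ∘G (ι ∘G leg c m)) ≈G leg (restrictCocone L π X) m
  FactorsNew = (u ∘G ℓ) ≈G newLeg L π X
  FactorsInserted = ∀ m → (u ∘G leg (insertCocone L π c ι ℓ sq) m) ≈G leg X m

insert-factors⁺ : ∀ {a d} (L : ZigList a) (π : Slot L d) {Q Q′ R} (c : Cocone (toZigzag L) Q)
                  (ι : GHom Q Q′) ℓ sq
                  (X : Cocone (toZigzag (insert L π)) R) u →
                  FactorsOld L π c ι ℓ sq X u → FactorsNew L π c ι ℓ sq X u →
                  FactorsInserted L π c ι ℓ sq X u
insert-factors⁺ (single n) (slot-single _) c ι ℓ sq X u old new zero = old zero
insert-factors⁺ (single n) (slot-single _) c ι ℓ sq X u old new (fsuc zero) = new
insert-factors⁺ (cons a b p q L) (slot-here _ _) c ι ℓ sq X u old new zero = old zero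
insert-factors⁺ (cons a b p q L) (slot-here _ _) c ι ℓ sq X u old new (fsuc zero) = new
insert-factors⁺ (cons a b p q L) (slot-here _ _) c ι ℓ sq X u old new (fsuc (fsuc m)) = old (fsuc m)
insert-factors⁺ (cons a b p q L) (slot-there π) c ι ℓ sq X u old new zero = old zero
insert-factors⁺ (cons a b p q L) (slot-there π) c ι ℓ sq X u old new (fsuc m) =
  insert-factors⁺ L π (tailCocone c) ι ℓ sq (tailCocone X) u (old ∘ fsuc) new m

insert-factors⁻ : ∀ {a d} (L : ZigList a) (π : Slot L d) {Q Q′ R} (c : Cocone (toZigzag L) Q)
                  (ι : GHom Q Q′) ℓ sq
                  (X : Cocone (toZigzag (insert L π)) R) u →
                  FactorsInserted L π c ι ℓ sq X u →
                  FactorsOld L π c ι ℓ sq X u × FactorsNew L π c ι ℓ sq X u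
insert-factors⁻ (single n) (slot-single _) c ι ℓ sq X u ins = (λ { zero → ins zero }) , ins (fsuc zero)
insert-factors⁻ (cons a b p q L) (slot-here _ _) c ι ℓ sq X u ins =
  (λ { zero → ins zero ; (fsuc m) → ins (fsuc (fsuc m)) }) , ins (fsuc zero)
insert-factors⁻ (cons a b p q L) (slot-there π) c ι ℓ sq X u ins
  with insert-factors⁻ L π (tailCocone c) ι ℓ sq (tailCocone X) u (ins ∘ fsuc)
... | old , new = (λ { zero → ins zero ; (fsuc m) → old m }) , new

insert-isColimit : ∀ {a d} (L : ZigList a) (π : Slot L d) {P} (c : Cocone (toZigzag L) P) →
                   IsColimit (toZigzag L) P c → {P′ : GSet} (po : Pushout P (n≤1+n d) (slotMap c π) P′) →
                   IsColimit (toZigzag (insert L π)) P′ (insertCocone L π c (incl po) (glued po) (square po))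
insert-isColimit L π {P} c colim {P′} po R X with colim R (restrictCocone L π X)
... | v , v-legs , v-unique
  with factor po R v (newLeg L π X) (λ k x → trans (v-legs (slotDisk π) k _) (newLeg-square L π X k x))
... | w , w-incl , w-new = w , insert-factors⁺ L π c (incl po) (glued po) (square po) X w w-old w-new , w-unique
  where
  w-old : FactorsOld L π c (incl po) (glued po) (square po) X w
  w-old m k x = trans (w-incl k _) (v-legs m k x)

  w-unique : (w′ : GHom P′ R) → FactorsInserted L π c (incl po) (glued po) (square po) X w′ → w′ ≈G w
  w-unique w′ ins with insert-factors⁻ L π c (incl po) (glued po) (square po) X w′ ins
  ... | w′-old , w′-new = unique po R w′ w
    (λ k x → trans (v-unique (w′ ∘G incl po) w′-old k x) (sym (v-unique (w ∘G incl po) w-old k x)))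
    (λ k x → trans (w′-new k x) (sym (w-new k x)))

slot-y : ∀ {a d} (L : ZigList a) (π : Slot L d) → Slot (insert L π) d
slot-y (single n) (slot-single {d = d} _) = slot-there (slot-single (n≤1+n d))
slot-y (cons a b p q L) (slot-here {d = d} _ b<d) = slot-there (slot-here (n≤1+n d) b<d)
slot-y (cons a b p q L) (slot-there π) = slot-there (slot-y L π)

slot-f : ∀ {a d} (L : ZigList a) (π : Slot L d) → Slot (insert L π) (suc d)
slot-f (single n) (slot-single _) = slot-there (slot-single ≤-refl)
slot-f (cons a b p q L) (slot-here _ b<d) = slot-there (slot-here ≤-refl (m≤n⇒m≤1+n b<d))
slot-f (cons a b p q L) (slot-there π) = slot-there (slot-f L π)

slotCell-y : ∀ {a d} (L : ZigList a) (π : Slot L d) {Q Q′} (c : Cocone (toZigzag L) Q) (ι : GHom Q Q′)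
             (ℓ : GHom (D (suc d)) Q′) (sq : GluingSquare π c ι ℓ) →
             slotCell (insertCocone L π c ι ℓ sq) (slot-y L π) ≡ topCell (ℓ ∘G τ (n≤1+n d))
slotCell-y (single n) (slot-single _) c ι ℓ sq = refl
slotCell-y (cons a b p q L) (slot-here _ _) c ι ℓ sq = refl
slotCell-y (cons a b p q L) (slot-there π) c ι ℓ sq = slotCell-y L π (tailCocone c) ι ℓ sq

slotCell-f : ∀ {a d} (L : ZigList a) (π : Slot L d) {Q Q′} (c : Cocone (toZigzag L) Q) (ι : GHom Q Q′)
             (ℓ : GHom (D (suc d)) Q′) (sq : GluingSquare π c ι ℓ) →
             slotCell (insertCocone L π c ι ℓ sq) (slot-f L π) ≡ topCell ℓ
slotCell-f (single n) (slot-single _) c ι ℓ sq = topCell-τ-refl ℓ ≤-refl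
slotCell-f (cons a b p q L) (slot-here _ _) c ι ℓ sq = topCell-τ-refl ℓ ≤-refl
slotCell-f (cons a b p q L) (slot-there π) c ι ℓ sq = slotCell-f L π (tailCocone c) ι ℓ sq

glued-lower-face : ∀ {a d} {L : ZigList a} (π : Slot L d) {Q Q′} (c : Cocone (toZigzag L) Q) (ι : GHom Q Q′)
                   (ℓ : GHom (D (suc d)) Q′) → GluingSquare π c ι ℓ → ∀ {d′} → d′ < d →
                   (r : d′ ≤ disks L (slotDisk π)) (s : d′ ≤ suc d) →
                   topCell {n = d′} (ℓ ∘G τ s) ≡ map ι d′ (topCell {n = d′} (leg c (slotDisk π) ∘G τ r))
glued-lower-face {d = d} π c ι ℓ sq {d′} d′<d r s =
  trans (cong (map ℓ d′) (sym (σ-τ-trans (<⇒≤ d′<d) (n≤1+n d) s d′<d d′ (top d′))))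
    (trans (sym (sq d′ _))
      (cong (map ι d′ ∘ map (leg c (slotDisk π)) d′) (τ-trans (<⇒≤ d′<d) (slotDisk≤ π) r d′ (top d′))))

τ-face-irrelevant : ∀ {Q n d} (l : GHom (D n) Q) (r r′ : d ≤ n) →
                    topCell {n = d} (l ∘G τ r) ≡ topCell {n = d} (l ∘G τ r′)
τ-face-irrelevant l r r′ rewrite ≤-irrelevant r r′ = refl

SlotAfterInsert : ∀ {a d d′} (L : ZigList a) (π : Slot L d) (ρ : Slot L d′) {Q Q′}
                  (c : Cocone (toZigzag L) Q) (ι : GHom Q Q′) (ℓ : GHom (D (suc d)) Q′) → GluingSquare π c ι ℓ → Set
SlotAfterInsert {d = d} {d′} L π ρ {Q} c ι ℓ sq =
  (Σ[ ρ′ ∈ Slot (insert L π) d′ ] slotCell (insertCocone L π c ι ℓ sq) ρ′ ≡ map ι d′ (slotCell c ρ))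
  ⊎ (Σ[ e ∈ d ≡ d′ ] subst (Cell Q) e (slotCell c π) ≡ slotCell c ρ)

slot-after-insert : ∀ {a d d′} (L : ZigList a) (π : Slot L d) (ρ : Slot L d′) {Q Q′}
                    (c : Cocone (toZigzag L) Q) (ι : GHom Q Q′) (ℓ : GHom (D (suc d)) Q′) (sq : GluingSquare π c ι ℓ) →
                    SlotAfterInsert L π ρ c ι ℓ sq
slot-after-insert {d = d} {d′} (single n) (slot-single r) (slot-single r′) c ι ℓ sq with <-cmp d′ d
... | tri< d′<d _ _ =
  inj₁ (slot-there (slot-single (m<n⇒m≤1+n d′<d)) ,
        glued-lower-face (slot-single r) c ι ℓ sq d′<d r′ (m<n⇒m≤1+n d′<d))
... | tri≈ _ refl _ = inj₂ (refl , τ-face-irrelevant (leg c zero) r r′)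
... | tri> _ _ d<d′ = inj₁ (slot-here r′ d<d′ , refl)
slot-after-insert {d = d} {d′} (cons a b p q L) (slot-here r b<d) (slot-here r′ b<d′) c ι ℓ sq with <-cmp d′ d
... | tri< d′<d _ _ =
  inj₁ (slot-there (slot-here (m<n⇒m≤1+n d′<d) b<d′) ,
        glued-lower-face (slot-here r b<d) c ι ℓ sq d′<d r′ (m<n⇒m≤1+n d′<d))
... | tri≈ _ refl _ = inj₂ (refl , τ-face-irrelevant (leg c zero) r r′)
... | tri> _ _ d<d′ = inj₁ (slot-here r′ d<d′ , refl)
slot-after-insert (cons a b p q L) (slot-here _ _) (slot-there ρ) c ι ℓ sq = inj₁ (slot-there (slot-there ρ) , refl)
slot-after-insert (cons a b p q L) (slot-there π) (slot-here r′ b<d′) c ι ℓ sq = inj₁ (slot-here r′ b<d′ , refl)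
slot-after-insert (cons a b p q L) (slot-there π) (slot-there ρ) c ι ℓ sq
  with slot-after-insert L π ρ (tailCocone c) ι ℓ sq
... | inj₁ (ρ′ , eq) = inj₁ (slot-there ρ′ , eq)
... | inj₂ same = inj₂ same

-- Derivations yield pasting schemes

record Realisation (Γ Δ : Ctx) : Set₁ where
  field
    S        : GSet
    iso      : S ≅GΓ Γ
    distinct : DistinctVars Γ
    start    : ℕ
    L        : ZigList start
    cocone   : Cocone (toZigzag L) S
    colimit  : IsColimit (toZigzag L) S cocone
    slotOf   : ∀ p → p ∈ Δ → Σ[ d ∈ ℕ ] Σ[ ρ ∈ Slot L d ] entry iso d (slotCell cocone ρ) ≡ p
    Δ-unique : Unique Δ

realisation-start : ∀ x → Realisation ((x , ⋆) ∷ []) ((x , ⋆) ∷ [])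
realisation-start x = record
  { S = D 0 ; iso = point≅ x ; distinct = λ { zero zero _ → refl } ; start = 0 ; L = single 0
  ; cocone = singleCocone idG
  ; colimit = λ Q X → leg X zero , (λ { zero _ _ → refl }) , (λ u′ agrees → agrees zero)
  ; slotOf = λ { p (here refl) → 0 , slot-single z≤n , refl }
  ; Δ-unique = [] ∷ [] }

module Extend {Γ : Ctx} (Δa : Ctx) (x : Var) (A : Ty) (Δb : Ctx) (y f : Var)
               (R : Realisation Γ (Δa ++ (x , A) ∷ Δb))
               (fresh-y : Fresh y Γ) (fresh-f : Fresh f Γ) (y≢f : y ≢ f) where
  open Realisation R

  private
    E : Ctx
    E = extension x A y f

    d : ℕ
    d = proj₁ (slotOf (x , A) (∈-insert Δa))

    π : Slot L d
    π = proj₁ (proj₂ (slotOf (x , A) (∈-insert Δa)))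

    c : Cell S d
    c = slotCell cocone π

    c-entry : entry iso d c ≡ (x , A)
    c-entry = proj₂ (proj₂ (slotOf (x , A) (∈-insert Δa)))

    po : Pushout S (n≤1+n d) (slotMap cocone π) (Glue S d c)
    po = gluePushout S d (slotMap cocone π) (n≤1+n d)

    iso⁺ : Glue S d c ≅GΓ (Γ ++ E)
    iso⁺ = glueIso iso c c-entry distinct fresh-y fresh-f

    cocone⁺ : Cocone (toZigzag (insert L π)) (Glue S d c)
    cocone⁺ = insertCocone L π cocone (incl po) (glued po) (square po)

    entry⁺ : ∀ k z → entry iso⁺ k z ≡ glueEntry iso c c-entry k z
    entry⁺ = entry-glueIso iso c c-entry distinct fresh-y fresh-f

    SlotFor : Var × Ty → Set
    SlotFor p = Σ[ d′ ∈ ℕ ] Σ[ ρ ∈ Slot (insert L π) d′ ] entry iso⁺ d′ (slotCell cocone⁺ ρ) ≡ p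

    old-slot : ∀ p → p ∈ Δa ++ Δb → SlotFor p
    old-slot p m with slotOf p (∈-insert⁺ Δa Δb m)
    ... | d′ , ρ , ρ-entry with slot-after-insert L π ρ cocone (incl po) (glued po) (square po)
    ...   | inj₁ (ρ′ , ρ′-cell) =
            d′ , ρ′ , trans (cong (entry iso⁺ d′) ρ′-cell) (trans (entry⁺ d′ _) ρ-entry)
    ...   | inj₂ (refl , same) =
            -- ρ is the filled slot, so p = (x , A), which occurs in Δ only once.
            ⊥-elim (All.lookup (proj₁ (Unique-insert⁻ Δa Δb Δ-unique)) m
                      (trans (sym c-entry) (trans (cong (entry iso d) same) ρ-entry)))

    y-slot : SlotFor (y , A)
    y-slot = d , slot-y L π , trans (cong (entry iso⁺ d) y-cell) (entry⁺ d (inj₂ new-y))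
      where
      y-cell : slotCell cocone⁺ (slot-y L π) ≡ inj₂ new-y
      y-cell = trans (slotCell-y L π cocone (incl po) (glued po) (square po)) (newDisk-τ S d c (n≤1+n d))

    f-slot : SlotFor (f , Hom A x y)
    f-slot = suc d , slot-f L π , trans (cong (entry iso⁺ (suc d)) f-cell) (entry⁺ (suc d) (inj₂ new-f))
      where
      f-cell : slotCell cocone⁺ (slot-f L π) ≡ inj₂ new-f
      f-cell = trans (slotCell-f L π cocone (incl po) (glued po) (square po)) (newDisk-top S d c)

    slotOf⁺ : ∀ p → p ∈ Δa ++ Δb ++ E → SlotFor p
    slotOf⁺ p m with ∈-appended⁻ Δa Δb E m
    ... | inj₁ m′ = old-slot p m′
    ... | inj₂ (here refl) = y-slot
    ... | inj₂ (there (here refl)) = f-slot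

    fresh-∉ : ∀ {v T} → Fresh v Γ → (v , T) ∉ Δa ++ Δb
    fresh-∉ fresh m with slotOf _ (∈-insert⁺ Δa Δb m)
    ... | d′ , ρ , ρ-entry = fresh-entryVar fresh (index iso d′ (slotCell cocone ρ)) (cong proj₁ ρ-entry)

    unique⁺ : Unique (Δa ++ Δb ++ E)
    unique⁺ = subst Unique (++-assoc Δa Δb E)
      (Unique.++⁺ (proj₂ (Unique-insert⁻ Δa Δb Δ-unique)) (((y≢f ∘ cong proj₁) ∷ []) ∷ [] ∷ [])
        λ { (m , here refl) → fresh-∉ fresh-y m ; (m , there (here refl)) → fresh-∉ fresh-f m })

  realisation : Realisation (Γ ++ E) (Δa ++ Δb ++ E)
  realisation = record
    { S = Glue S d c ; iso = iso⁺ ; distinct = DistinctVars-extend distinct fresh-y fresh-f y≢f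
    ; start = start ; L = insert L π ; cocone = cocone⁺
    ; colimit = insert-isColimit L π cocone colimit po
    ; slotOf = slotOf⁺ ; Δ-unique = unique⁺ }

realise : ∀ {Γ Δ} → Γ ⊢ps Δ → Realisation Γ Δ
realise (ps-start x) = realisation-start x
realise (ps-ext Δa x A Δb y f der fresh-y fresh-f y≢f) =
  Extend.realisation Δa x A Δb y f (realise der) fresh-y fresh-f y≢f

ps⇒pastingScheme : (Γ : Ctx) → Γ ⊢ps → Σ[ P ∈ GSet ] (IsPastingScheme P × (P ≅GΓ Γ))
ps⇒pastingScheme Γ (ps-done der) = S , (toZigzag L , cocone , colimit) , iso
  where open Realisation (realise der)

-- Pasting schemes come from derivations

Bounded : Ctx → ℕ → Set
Bounded Γ N = ∀ v → Any (OccEntry v) Γ → v < N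

Bounded-fresh : ∀ {Γ N v} → Bounded Γ N → N ≤ v → Fresh v Γ
Bounded-fresh {v = v} bounded N≤v occ = <-irrefl refl (<-≤-trans (bounded v occ) N≤v)

Bounded-extend : ∀ {Γ N x A} (e : Fin (length Γ)) → lookup Γ e ≡ (x , A) → Bounded Γ N →
                 Bounded (Γ ++ extension x A N (suc N)) (suc (suc N))
Bounded-extend {Γ} {N} {x} {A} e e-entry bounded v occ = by-cases (++⁻ Γ occ)
  where
  old : v < N → v < suc (suc N)
  old = m<n⇒m<1+n ∘ m<n⇒m<1+n

  via-entry : OccEntry v (x , A) → v < suc (suc N)
  via-entry o = old (bounded v (lose (∈-lookup e) (subst (OccEntry v) (sym e-entry) o)))

  by-cases : Any (OccEntry v) Γ ⊎ Any (OccEntry v) (extension x A N (suc N)) → v < suc (suc N)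
  by-cases (inj₁ occΓ) = old (bounded v occΓ)
  by-cases (inj₂ (here (inj₁ refl))) = m<n⇒m<1+n (n<1+n N)
  by-cases (inj₂ (here (inj₂ occA))) = via-entry (inj₂ occA)
  by-cases (inj₂ (there (here (inj₁ refl)))) = n<1+n (suc N)
  by-cases (inj₂ (there (here (inj₂ (inj₁ (inj₁ refl)))))) = via-entry (inj₁ refl)
  by-cases (inj₂ (there (here (inj₂ (inj₁ (inj₂ refl)))))) = m<n⇒m<1+n (n<1+n N)
  by-cases (inj₂ (there (here (inj₂ (inj₂ occA))))) = via-entry (inj₂ occA)

record Built : Set₁ where
  field
    Γ Δ      : Ctx
    der      : Γ ⊢ps Δ
    S        : GSet
    iso      : S ≅GΓ Γ
    distinct : DistinctVars Γ
    bound    : ℕ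
    bounded  : Bounded Γ bound
open Built

TargetFacesIn : (B : Built) (j : ℕ) → GHom (D j) (S B) → Set
TargetFacesIn B j h = ∀ k (p : k ≤ j) → entry (iso B) k (topCell {n = k} (h ∘G τ p)) ∈ Δ B

TargetFacesIn-τ : ∀ B {i j} {h : GHom (D i) (S B)} → TargetFacesIn B i h → (q : j ≤ i) →
                  TargetFacesIn B j (h ∘G τ q)
TargetFacesIn-τ B {h = h} faces q k p =
  subst (λ z → entry (iso B) k (map h k z) ∈ Δ B) (sym (τ-trans p q (≤-trans p q) k (top k)))
        (faces k (≤-trans p q))

point : Built
point = record
  { Γ = (0 , ⋆) ∷ [] ; Δ = (0 , ⋆) ∷ [] ; der = ps-start 0 ; S = D 0 ; iso = point≅ 0
  ; distinct = λ { zero zero _ → refl } ; bound = 1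
  ; bounded = λ { v (here (inj₁ refl)) → s≤s z≤n } }

point-faces : TargetFacesIn point 0 idG
point-faces zero z≤n = here refl

module GlueStep (B : Built) (i : ℕ) (ℓ : GHom (D i) (S B)) (faces : TargetFacesIn B i ℓ) where
  private
    c : Cell (S B) i
    c = topCell ℓ

    x : Var
    x = proj₁ (entry (iso B) i c)

    A : Ty
    A = proj₂ (entry (iso B) i c)

    c∈Δ : (x , A) ∈ Δ B
    c∈Δ = subst (λ z → entry (iso B) i z ∈ Δ B) (topCell-τ-refl ℓ ≤-refl) (faces i ≤-refl)

    Δa Δb : Ctx
    Δa = proj₁ (∈-∃++ c∈Δ)
    Δb = proj₁ (proj₂ (∈-∃++ c∈Δ))

    Δ-split : Δ B ≡ Δa ++ (x , A) ∷ Δb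
    Δ-split = proj₂ (proj₂ (∈-∃++ c∈Δ))

    y f : Var
    y = bound B
    f = suc (bound B)

    fresh-y : Fresh y (Γ B)
    fresh-y = Bounded-fresh (bounded B) ≤-refl

    fresh-f : Fresh f (Γ B)
    fresh-f = Bounded-fresh (bounded B) (n≤1+n _)

    y≢f : y ≢ f
    y≢f eq = <-irrefl eq (n<1+n _)

    iso⁺ : Glue (S B) i c ≅GΓ (Γ B ++ extension x A y f)
    iso⁺ = glueIso (iso B) c refl (distinct B) fresh-y fresh-f

    Δ⁺ : Ctx
    Δ⁺ = Δa ++ Δb ++ extension x A y f

  built : Built
  built = record
    { Γ = Γ B ++ extension x A y f ; Δ = Δ⁺
    ; der = ps-ext Δa x A Δb y f (subst (Γ B ⊢ps_) Δ-split (der B)) fresh-y fresh-f y≢f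
    ; S = Glue (S B) i c ; iso = iso⁺
    ; distinct = DistinctVars-extend (distinct B) fresh-y fresh-f y≢f
    ; bound = suc (suc (bound B)) ; bounded = Bounded-extend (index (iso B) i c) refl (bounded B) }

  po : Pushout (S B) (n≤1+n i) ℓ (S built)
  po = gluePushout (S B) i ℓ (n≤1+n i)

  private
    face-∈ : ∀ {k} {s : GlueCell (S B) i k} z → s ≡ z → glueEntry (iso B) c refl {y} {f} k z ∈ Δ⁺ →
             entry iso⁺ k s ∈ Δ⁺
    face-∈ z refl = subst (_∈ Δ⁺) (sym (entry-glueIso (iso B) c refl (distinct B) fresh-y fresh-f _ z))

    lower-face : ∀ {k} (k<i : k < i) (p : k ≤ suc i) →
                 topCell {n = k} (glued po ∘G τ p) ≡ inj₁ (topCell {n = k} (ℓ ∘G τ (<⇒≤ k<i)))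
    lower-face {k} k<i p =
      trans (cong (map (glued po) k) (sym (σ-τ-trans (<⇒≤ k<i) (n≤1+n i) p k<i k (top k))))
            (sym (square po k (τmap (<⇒≤ k<i) k (top k))))

    old-face : ∀ {k} (k<i : k < i) → entry (iso B) k (topCell {n = k} (ℓ ∘G τ (<⇒≤ k<i))) ∈ Δa ++ Δb
    old-face {k} k<i =
      ∈-insert⁻ Δa Δb (subst (_ ∈_) Δ-split (faces k (<⇒≤ k<i)))
        (λ eq → <-irrefl (trans (sym (entry-dim (iso B) k _))
                           (trans (cong (dim ∘ proj₂) eq) (entry-dim (iso B) i c))) k<i)

  faces⁺ : TargetFacesIn built (suc i) (glued po)
  faces⁺ k p with m≤n⇒m<n∨m≡n p
  ... | inj₂ refl =
        face-∈ (inj₂ new-f) (trans (topCell-τ-refl (glued po) p) (newDisk-top (S B) i c))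
               (∈-appended⁺ʳ Δa Δb _ (there (here refl)))
  ... | inj₁ (s≤s k≤i) with m≤n⇒m<n∨m≡n k≤i
  ...   | inj₂ refl = face-∈ (inj₂ new-y) (newDisk-τ (S B) i c p) (∈-appended⁺ʳ Δa Δb _ (here refl))
  ...   | inj₁ k<i = face-∈ (inj₁ _) (lower-face k<i p) (∈-appended⁺ˡ Δa Δb _ (old-face k<i))

glueChain : (B : Built) {j i : ℕ} (h : GHom (D j) (S B)) → TargetFacesIn B j h → (p : j ≤ i) →
            Σ[ B′ ∈ Built ] Σ[ po ∈ Pushout (S B) p h (S B′) ] TargetFacesIn B′ i (glued po)
glueChain B {j} h faces p = go (≤⇒≤′ p) p
  where
  go : ∀ {i} → j ≤′ i → (p : j ≤ i) →
       Σ[ B′ ∈ Built ] Σ[ po ∈ Pushout (S B) p h (S B′) ] TargetFacesIn B′ i (glued po)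
  go ≤′-refl p = B , Pushout-refl p h , faces
  go (≤′-step {i} q) p with go q (≤′⇒≤ q)
  ... | B₁ , po₁ , faces₁ = built , Pushout-cast (Pushout-paste po₁ po) , faces⁺
    where open GlueStep B₁ i (glued po₁) faces₁

zigzag : (k : ℕ) (is : Fin (suc k) → ℕ) (js : Fin k → ℕ) →
         (∀ m → js m ≤ is (inject₁ m)) → (∀ m → js m ≤ is (fsuc m)) → Zigzag
zigzag k is js l r = record { len = k ; i = is ; j = js ; j≤il = l ; j≤ir = r }

module Snoc (k : ℕ) (is : Fin (suc (suc k)) → ℕ) (js : Fin (suc k) → ℕ)
            (l : ∀ m → js m ≤ is (inject₁ m)) (r : ∀ m → js m ≤ is (fsuc m)) where
  Z Z⁻ : Zigzag
  Z = zigzag (suc k) is js l r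
  Z⁻ = zigzag k (is ∘ inject₁) (js ∘ inject₁) (l ∘ inject₁) (r ∘ inject₁)

  lastJoin : ∀ {P} → Cocone Z⁻ P → GHom (D (js (fromℕ k))) P
  lastJoin c = leg c (fromℕ k) ∘G τ (l (fromℕ k))

  module _ {P} (c : Cocone Z⁻ P) {P′} (po : Pushout P (r (fromℕ k)) (lastJoin c) P′) where
    legs : (m : Fin (suc (suc k))) → GHom (D (is m)) P′
    legs m with view m
    ... | ‵fromℕ = glued po
    ... | ‵inj₁ {i = m′} _ = incl po ∘G leg c m′

    legs-inject₁ : ∀ m → legs (inject₁ m) ≡ incl po ∘G leg c m
    legs-inject₁ m rewrite view-inject₁ m = refl

    legs-last : legs (fromℕ (suc k)) ≡ glued po
    legs-last rewrite view-fromℕ (suc k) = refl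

    legs-commute : ∀ m → View m → (legs (inject₁ m) ∘G τ (l m)) ≈G (legs (fsuc m) ∘G σ (r m))
    legs-commute .(fromℕ k) ‵fromℕ rewrite legs-inject₁ (fromℕ k) | legs-last = square po
    legs-commute .(inject₁ m) (‵inj₁ {i = m} _) rewrite legs-inject₁ (inject₁ m) | legs-inject₁ (fsuc m) =
      λ n x → cong (map (incl po) n) (commut c m n x)

    snocCocone : Cocone Z P′
    snocCocone = record { leg = legs ; commut = λ m → legs-commute m (view m) }

    snoc-isColimit : IsColimit Z⁻ P c → IsColimit Z P′ snocCocone
    snoc-isColimit colim Q X with colim Q (record { leg = leg X ∘ inject₁ ; commut = commut X ∘ inject₁ })
    ... | v , v-legs , v-unique
      with factor po Q v (leg X (fromℕ (suc k))) (λ n x → trans (v-legs (fromℕ k) n _) (commut X (fromℕ k) n x))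
    ... | w , w-incl , w-glued = w , (λ m → w-legs m (view m)) , w-unique
      where
      w-legs : ∀ m → View m → (w ∘G legs m) ≈G leg X m
      w-legs .(fromℕ (suc k)) ‵fromℕ rewrite legs-last = w-glued
      w-legs .(inject₁ m) (‵inj₁ {i = m} _) rewrite legs-inject₁ m = λ n x → trans (w-incl n _) (v-legs m n x)

      w-unique : (w′ : GHom P′ Q) → (∀ m → (w′ ∘G legs m) ≈G leg X m) → w′ ≈G w
      w-unique w′ w′-legs = unique po Q w′ w
        (λ n x → trans (v-unique (w′ ∘G incl po) w′-old n x)
                       (sym (v-unique (w ∘G incl po) (λ m n′ y → trans (w-incl n′ _) (v-legs m n′ y)) n x)))
        (λ n x → trans (cong (λ g → map (w′ ∘G g) n x) (sym legs-last))
                       (trans (w′-legs (fromℕ (suc k)) n x) (sym (w-glued n x))))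
        where
        w′-old : ∀ m → ((w′ ∘G incl po) ∘G leg c m) ≈G leg X (inject₁ m)
        w′-old m n y = trans (cong (λ g → map (w′ ∘G g) n y) (sym (legs-inject₁ m))) (w′-legs (inject₁ m) n y)

record BuiltColimit (Z : Zigzag) : Set₁ where
  field
    built   : Built
    cocone  : Cocone Z (S built)
    colimit : IsColimit Z (S built) cocone
    faces   : TargetFacesIn built (i Z (fromℕ (len Z))) (leg cocone (fromℕ (len Z)))

singletonCocone : ∀ is js l r {P} → GHom (D (is zero)) P → Cocone (zigzag 0 is js l r) P
singletonCocone is js l r h = record { leg = λ { zero → h } ; commut = λ () }

singleton-isColimit : ∀ is js l r {P} (po : Pushout (D 0) (z≤n {is zero}) idG P) →
                      IsColimit (zigzag 0 is js l r) P (singletonCocone is js l r (glued po))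
singleton-isColimit is js l r {P} po Q X
  with factor po Q (leg X zero ∘G σ (z≤n {is zero})) (leg X zero) (λ _ _ → refl)
... | w , _ , w-glued = w , (λ { zero → w-glued }) , w-unique
  where
  w-unique : (w′ : GHom P Q) → (∀ m → (w′ ∘G leg (singletonCocone is js l r (glued po)) m) ≈G leg X m) →
             w′ ≈G w
  w-unique w′ w′-legs = unique po Q w′ w
    (λ k x → trans (cong (map w′ k) (square po k x))
               (trans (w′-legs zero k (σmap (z≤n {is zero}) k x))
                 (sym (trans (cong (map w k) (square po k x)) (w-glued k (σmap (z≤n {is zero}) k x))))))
    (λ k x → trans (w′-legs zero k x) (sym (w-glued k x)))

buildColimit : ∀ k is js l r → BuiltColimit (zigzag k is js l r)
buildColimit zero is js l r with glueChain point idG point-faces (z≤n {is zero})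
... | B , po , faces = record
  { built = B ; cocone = singletonCocone is js l r (glued po)
  ; colimit = singleton-isColimit is js l r po ; faces = faces }
buildColimit (suc k) is js l r
  with buildColimit k (is ∘ inject₁) (js ∘ inject₁) (l ∘ inject₁) (r ∘ inject₁)
... | record { built = B ; cocone = c ; colimit = colim ; faces = faces }
  with glueChain B (Snoc.lastJoin k is js l r c)
                   (TargetFacesIn-τ B {h = leg c (fromℕ k)} faces (l (fromℕ k))) (r (fromℕ k))
... | B′ , po , faces′ = record
  { built = B′ ; cocone = snocCocone c po ; colimit = snoc-isColimit c po colim
  ; faces = subst (TargetFacesIn B′ (is (fromℕ (suc k)))) (sym (legs-last c po)) faces′ }
  where open Snoc k is js l r

pastingScheme⇒ps : (P : GSet) → IsPastingScheme P → Σ[ Γ ∈ Ctx ] (Γ ⊢ps × (P ≅GΓ Γ))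
pastingScheme⇒ps P (Z , c , colim)
  with buildColimit (len Z) (i Z) (j Z) (j≤il Z) (j≤ir Z)
... | record { built = B ; cocone = c′ ; colimit = colim′ }
  with colimit-unique {cP = c} {cS = c′} colim colim′
... | u , v , vu , uv = Γ B , ps-done (der B) , ≅GΓ-transport u v vu uv (iso B)

mainTheorem6 : ((Γ : Ctx) → Γ ⊢ps → Σ[ P ∈ GSet ] (IsPastingScheme P × (P ≅GΓ Γ)))
               × ((P : GSet) → IsPastingScheme P → Σ[ Γ ∈ Ctx ] (Γ ⊢ps × (P ≅GΓ Γ)))
mainTheorem6 = ps⇒pastingScheme , pastingScheme⇒ps
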